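{- Let $A_0(x,z)=\sum_{n\ge 0}\sum_{k=0}^{n}a_{n,0,k}x^kz^n$ and $A(x,y,z)=\sum_{n\ge 0}\sum_{m=0}^{n}\sum_{k=0}^{n}a_{n,m,k}x^ky^mz^n$ (the empty path contributes the constant term $1$). Then $$A(x,y,z)=\frac{A_0(x,z)A_0(x,yz)}{1-x\,[A_0(x,z)-1]\,[A_0(x,yz)-1]}.$$
   Context: A Dyck path of semilength $n\ge 0$ is a lattice path in $\mathbb{Z}\times\mathbb{Z}$ from $(0,0)$ to $(2n,0)$ using up steps $U=(1,1)$ and down steps $D=(1,-1)$; it is allowed to go below the $x$-axis. Write it as a word $P_1P_2\cdots P_{2n}$ over $\{U,D\}$. An up step is under the $x$-axis if it goes from height $-h$ to height $-h+1$ for some $h\ge 1$. A Dyck path is $(n,m)$-flawed if it has semilength $n$ and exactly $m$ up steps under the $x$-axis. A double ascent is a position $i$ with $P_iP_{i+1}=UU$. Let $a_{n,m,k}$ be the number of $(n,m)$-flawed paths with exactly $k$ double ascents. -}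

module Defs where

open import Data.Bool using (Bool; true; false; if_then_else_; _∧_)
open import Data.Nat using (ℕ; zero; suc; _+_; _*_; _∸_; _≡ᵇ_)
open import Data.Integer as ℤ using (ℤ; +_; -[1+_])
open import Data.List using (List; []; _∷_; length; filter; concatMap)
open import Relation.Nullary.Decidable using (yes; no)
open import Relation.Binary.PropositionalEquality using (_≡_)
open import Data.Bool.Properties using (T?)

-- Paths as words over {U,D}: true = U (up step), false = D (down step)

Word : Set
Word = List Bool

words : ℕ → List Word
words zero    = [] ∷ []
words (suc l) = concatMap (λ w → (true ∷ w) ∷ (false ∷ w) ∷ []) (words l)

ups : Word → ℕ
ups []           = 0
ups (true ∷ w)   = suc (ups w)
ups (false ∷ w)  = ups w

downs : Word → ℕ
downs []          = 0
downs (true ∷ w)  = downs w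
downs (false ∷ w) = suc (downs w)

-- a word of length 2n is a (possibly flawed) Dyck path of semilength n
-- iff it ends at height 0, i.e. #U = #D
endsAtZero : Word → Bool
endsAtZero w = ups w ≡ᵇ downs w

isNeg : ℤ → Bool
isNeg (+ _)    = false
isNeg -[1+ _ ] = true

-- number of up steps under the x-axis, starting at height h:
-- an up step from height -h' (h' ≥ 1) to -h'+1
underUpsFrom : ℤ → Word → ℕ
underUpsFrom h []          = 0
underUpsFrom h (true ∷ w)  = (if isNeg h then 1 else 0) + underUpsFrom (h ℤ.+ ℤ.1ℤ) w
underUpsFrom h (false ∷ w) = underUpsFrom (h ℤ.- ℤ.1ℤ) w

underUps : Word → ℕ
underUps = underUpsFrom ℤ.0ℤ

doubleAscents : Word → ℕ
doubleAscents []                    = 0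
doubleAscents (true ∷ true ∷ w)     = suc (doubleAscents (true ∷ w))
doubleAscents (_ ∷ w)               = doubleAscents w

a : ℕ → ℕ → ℕ → ℕ
a n m k = length (filter (λ w → T? (endsAtZero w ∧ (underUps w ≡ᵇ m) ∧ (doubleAscents w ≡ᵇ k)))
                         (words (2 * n)))

-- Formal power series in x, y, z with integer coefficients,
-- represented by coefficient functions:  F k m n = [x^k y^m z^n] F.

FPS : Set
FPS = ℕ → ℕ → ℕ → ℤ

Σ≤ : ℕ → (ℕ → ℤ) → ℤ
Σ≤ zero    f = f 0
Σ≤ (suc n) f = Σ≤ n f ℤ.+ f (suc n)

_⊛_ : FPS → FPS → FPS
(F ⊛ G) k m n = Σ≤ k λ i → Σ≤ m λ j → Σ≤ n λ l →
                  F i j l ℤ.* G (k ∸ i) (m ∸ j) (n ∸ l)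

_⊕_ : FPS → FPS → FPS
(F ⊕ G) k m n = F k m n ℤ.+ G k m n

_⊖_ : FPS → FPS → FPS
(F ⊖ G) k m n = F k m n ℤ.- G k m n

𝟙 : FPS
𝟙 zero zero zero = ℤ.1ℤ
𝟙 _    _    _    = ℤ.0ℤ

𝕩 : FPS
𝕩 (suc zero) zero zero = ℤ.1ℤ
𝕩 _          _    _    = ℤ.0ℤ

A : FPS
A k m n = + a n m k

A₀[x,z] : FPS
A₀[x,z] k zero    n = + a n 0 k
A₀[x,z] k (suc m) n = ℤ.0ℤ

-- A₀(x,yz) = Σ a_{n,0,k} x^k y^n z^n
A₀[x,yz] : FPS
A₀[x,yz] k m n = if m ≡ᵇ n then + a n 0 k else ℤ.0ℤ

-- Cut a flawed path at its first down step from height 0: A = P T, where P counts the paths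
-- weakly above the axis and T the flawed paths that are empty or start with D. A nonempty path
-- of T either stays weakly below the axis, or is a nonempty such path followed by a flawed path
-- starting with U, the junction being a double ascent; and the flawed paths starting with U are
-- A − T = (P − 1) T. So T = Q + x (Q − 1)(P − 1) T and A = P T = P Q + x (P − 1)(Q − 1) A, with Q
-- counting the paths weakly below the axis. Finally P = A₀(x,z), and reversal identifies Q with
-- A₀(x,yz). Series are handled through weighted classes: for each semilength, the list of weights
-- (double ascents, up steps under the axis) of its paths.
module Submission where

open import Algebra.Properties.CommutativeSemigroup using (interchange)
open import Data.Bool using (Bool; true; false; if_then_else_; _∧_; not; T)
open import Data.Bool.Properties using (∧-zeroʳ; ∧-identityʳ; ∧-comm; T?)
open import Data.Empty using (⊥-elim)
open import Data.Integer as ℤ using (ℤ; -[1+_]) renaming (+_ to pos)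
import Data.Integer.Properties as ℤ
open import Algebra.Properties.AbelianGroup ℤ.+-0-abelianGroup using (xyx⁻¹≈y)
open import Data.Integer.Solver using () renaming (module +-*-Solver to ℤS)
open import Data.List using (List; []; _∷_; _++_; _∷ʳ_; map; concatMap; length; take; drop; filter; reverse; null)
open import Data.List.Properties using (take++drop≡id; unfold-reverse)
open import Data.Nat
open import Data.Nat.Properties
open import Data.Nat.Solver using () renaming (module +-*-Solver to ℕS)
open import Data.Product using (_×_; _,_; proj₁; proj₂)
open import Data.Sum using (inj₁; inj₂)
open import Relation.Binary.Bundles using (Setoid)
import Relation.Binary.Reasoning.Setoid as SetoidReasoning
open import Relation.Binary.PropositionalEquality
open import Relation.Nullary using (yes; no)
open import Defs

open ≡-Reasoning

+-interchange : ∀ a b c d → (a + b) + (c + d) ≡ (a + c) + (b + d)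
+-interchange = interchange +-commutativeSemigroup

*-interchange : ∀ a b c d → (a * b) * (c * d) ≡ (a * c) * (b * d)
*-interchange = interchange *-commutativeSemigroup

ΣL : {X : Set} → List X → (X → ℕ) → ℕ
ΣL []       g = 0
ΣL (x ∷ xs) g = g x + ΣL xs g

module _ {X : Set} where

  ΣL-++ : (xs ys : List X) (g : X → ℕ) → ΣL (xs ++ ys) g ≡ ΣL xs g + ΣL ys g
  ΣL-++ []       ys g = refl
  ΣL-++ (x ∷ xs) ys g = trans (cong (g x +_) (ΣL-++ xs ys g)) (sym (+-assoc (g x) _ _))

  ΣL-cong : (xs : List X) {g h : X → ℕ} → (∀ x → g x ≡ h x) → ΣL xs g ≡ ΣL xs h
  ΣL-cong []       e = refl
  ΣL-cong (x ∷ xs) e = cong₂ _+_ (e x) (ΣL-cong xs e)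

  ΣL-zero : (xs : List X) (g : X → ℕ) → (∀ x → g x ≡ 0) → ΣL xs g ≡ 0
  ΣL-zero []       g e = refl
  ΣL-zero (x ∷ xs) g e = cong₂ _+_ (e x) (ΣL-zero xs g e)

  ΣL-+ : (xs : List X) (g h : X → ℕ) → ΣL xs (λ x → g x + h x) ≡ ΣL xs g + ΣL xs h
  ΣL-+ []       g h = refl
  ΣL-+ (x ∷ xs) g h = trans (cong (g x + h x +_) (ΣL-+ xs g h)) (+-interchange (g x) (h x) _ _)

  ΣL-*ˡ : (xs : List X) (c : ℕ) (g : X → ℕ) → ΣL xs (λ x → c * g x) ≡ c * ΣL xs g
  ΣL-*ˡ []       c g = sym (*-zeroʳ c)
  ΣL-*ˡ (x ∷ xs) c g = trans (cong (c * g x +_) (ΣL-*ˡ xs c g)) (sym (*-distribˡ-+ c (g x) _))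

  ΣL-*ʳ : (xs : List X) (c : ℕ) (g : X → ℕ) → ΣL xs (λ x → g x * c) ≡ ΣL xs g * c
  ΣL-*ʳ xs c g = trans (ΣL-cong xs (λ x → *-comm (g x) c)) (trans (ΣL-*ˡ xs c g) (*-comm c _))

module _ {X Y : Set} where

  ΣL-concatMap : (h : X → List Y) (xs : List X) (g : Y → ℕ) →
    ΣL (concatMap h xs) g ≡ ΣL xs (λ x → ΣL (h x) g)
  ΣL-concatMap h []       g = refl
  ΣL-concatMap h (x ∷ xs) g =
    trans (ΣL-++ (h x) (concatMap h xs) g) (cong (ΣL (h x) g +_) (ΣL-concatMap h xs g))

  ΣL-map : (h : X → Y) (xs : List X) (g : Y → ℕ) → ΣL (map h xs) g ≡ ΣL xs (λ x → g (h x))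
  ΣL-map h []       g = refl
  ΣL-map h (x ∷ xs) g = cong (g (h x) +_) (ΣL-map h xs g)

  ΣL-swap : (xs : List X) (ys : List Y) (g : X → Y → ℕ) →
    ΣL xs (λ x → ΣL ys (g x)) ≡ ΣL ys (λ y → ΣL xs (λ x → g x y))
  ΣL-swap []       ys g = sym (ΣL-zero ys _ (λ _ → refl))
  ΣL-swap (x ∷ xs) ys g =
    trans (cong (ΣL ys (g x) +_) (ΣL-swap xs ys g)) (sym (ΣL-+ ys (g x) (λ y → ΣL xs (λ x → g x y))))

  ΣL-product : (xs : List X) (ys : List Y) (g : X → ℕ) (h : Y → ℕ) →
    ΣL xs g * ΣL ys h ≡ ΣL xs (λ x → ΣL ys (λ y → g x * h y))
  ΣL-product xs ys g h = trans (sym (ΣL-*ʳ xs (ΣL ys h) g)) (ΣL-cong xs (λ x → sym (ΣL-*ˡ ys (g x) h)))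

range : ℕ → List ℕ
range zero    = 0 ∷ []
range (suc n) = range n ++ (suc n ∷ [])

Σ≤ℕ : ℕ → (ℕ → ℕ) → ℕ
Σ≤ℕ n g = ΣL (range n) g

Σ≤ℕ-suc : ∀ n g → Σ≤ℕ (suc n) g ≡ Σ≤ℕ n g + g (suc n)
Σ≤ℕ-suc n g = trans (ΣL-++ (range n) _ g) (cong (Σ≤ℕ n g +_) (+-identityʳ (g (suc n))))

Σ≤ℕ-cong : ∀ n {g h : ℕ → ℕ} → (∀ i → i ≤ n → g i ≡ h i) → Σ≤ℕ n g ≡ Σ≤ℕ n h
Σ≤ℕ-cong zero    e = cong (_+ 0) (e 0 z≤n)
Σ≤ℕ-cong (suc n) {g} {h} e = begin
  Σ≤ℕ (suc n) g       ≡⟨ Σ≤ℕ-suc n g ⟩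
  Σ≤ℕ n g + g (suc n) ≡⟨ cong₂ _+_ (Σ≤ℕ-cong n (λ i i≤n → e i (m≤n⇒m≤1+n i≤n))) (e (suc n) ≤-refl) ⟩
  Σ≤ℕ n h + h (suc n) ≡⟨ Σ≤ℕ-suc n h ⟨
  Σ≤ℕ (suc n) h       ∎

Σ≤ℕ-zero : ∀ n {g : ℕ → ℕ} → (∀ i → i ≤ n → g i ≡ 0) → Σ≤ℕ n g ≡ 0
Σ≤ℕ-zero n e = trans (Σ≤ℕ-cong n e) (ΣL-zero (range n) _ (λ _ → refl))

Σ≤ℕ-shift : ∀ n g → Σ≤ℕ (suc n) g ≡ g 0 + Σ≤ℕ n (λ i → g (suc i))
Σ≤ℕ-shift zero    g = refl
Σ≤ℕ-shift (suc n) g = begin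
  Σ≤ℕ (suc (suc n)) g                                ≡⟨ Σ≤ℕ-suc (suc n) g ⟩
  Σ≤ℕ (suc n) g + g (suc (suc n))                    ≡⟨ cong (_+ g (suc (suc n))) (Σ≤ℕ-shift n g) ⟩
  g 0 + Σ≤ℕ n (λ i → g (suc i)) + g (suc (suc n))    ≡⟨ +-assoc (g 0) _ _ ⟩
  g 0 + (Σ≤ℕ n (λ i → g (suc i)) + g (suc (suc n)))  ≡⟨ cong (g 0 +_) (Σ≤ℕ-suc n (λ i → g (suc i))) ⟨
  g 0 + Σ≤ℕ (suc n) (λ i → g (suc i))                ∎

Σ≤ℕ-reverse : ∀ n g → Σ≤ℕ n g ≡ Σ≤ℕ n (λ i → g (n ∸ i))
Σ≤ℕ-reverse zero    g = refl
Σ≤ℕ-reverse (suc n) g = begin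
  Σ≤ℕ (suc n) g
    ≡⟨ Σ≤ℕ-shift n g ⟩
  g 0 + Σ≤ℕ n (λ i → g (suc i))
    ≡⟨ +-comm (g 0) _ ⟩
  Σ≤ℕ n (λ i → g (suc i)) + g 0
    ≡⟨ cong₂ _+_ (Σ≤ℕ-reverse n (λ i → g (suc i))) (cong g (sym (n∸n≡0 (suc n)))) ⟩
  Σ≤ℕ n (λ i → g (suc (n ∸ i))) + g (suc n ∸ suc n)
    ≡⟨ cong (_+ g (suc n ∸ suc n)) (Σ≤ℕ-cong n (λ i i≤n → cong g (sym (+-∸-assoc 1 i≤n)))) ⟩
  Σ≤ℕ n (λ i → g (suc n ∸ i)) + g (suc n ∸ suc n)
    ≡⟨ Σ≤ℕ-suc n (λ i → g (suc n ∸ i)) ⟨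
  Σ≤ℕ (suc n) (λ i → g (suc n ∸ i)) ∎

Σ≤ℕ-triangle : ∀ n (G : ℕ → ℕ → ℕ) →
  Σ≤ℕ n (λ s → Σ≤ℕ s (λ l → G l (s ∸ l))) ≡ Σ≤ℕ n (λ l → Σ≤ℕ (n ∸ l) (G l))
Σ≤ℕ-triangle zero    G = refl
Σ≤ℕ-triangle (suc n) G = begin
  Σ≤ℕ (suc n) (λ s → Σ≤ℕ s (λ l → G l (s ∸ l)))
    ≡⟨ Σ≤ℕ-suc n _ ⟩
  Σ≤ℕ n (λ s → Σ≤ℕ s (λ l → G l (s ∸ l))) + Σ≤ℕ (suc n) (λ l → G l (suc n ∸ l))
    ≡⟨ cong₂ _+_ (Σ≤ℕ-triangle n G) (trans (Σ≤ℕ-suc n _) (cong (λ z → diagonal + G (suc n) z) (n∸n≡0 n))) ⟩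
  Σ≤ℕ n (λ l → Σ≤ℕ (n ∸ l) (G l)) + (diagonal + G (suc n) 0)
    ≡⟨ +-assoc (Σ≤ℕ n (λ l → Σ≤ℕ (n ∸ l) (G l))) _ _ ⟨
  Σ≤ℕ n (λ l → Σ≤ℕ (n ∸ l) (G l)) + diagonal + G (suc n) 0
    ≡⟨ cong (_+ G (suc n) 0) (ΣL-+ (range n) _ _) ⟨
  Σ≤ℕ n (λ l → Σ≤ℕ (n ∸ l) (G l) + G l (suc n ∸ l)) + G (suc n) 0
    ≡⟨ cong (_+ G (suc n) 0) (Σ≤ℕ-cong n extend-row) ⟩
  Σ≤ℕ n (λ l → Σ≤ℕ (suc n ∸ l) (G l)) + G (suc n) 0
    ≡⟨ cong (λ z → Σ≤ℕ n (λ l → Σ≤ℕ (suc n ∸ l) (G l)) + z)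
            (trans (cong (λ z → Σ≤ℕ z (G (suc n))) (n∸n≡0 (suc n))) (+-identityʳ _)) ⟨
  Σ≤ℕ n (λ l → Σ≤ℕ (suc n ∸ l) (G l)) + Σ≤ℕ (suc n ∸ suc n) (G (suc n))
    ≡⟨ Σ≤ℕ-suc n _ ⟨
  Σ≤ℕ (suc n) (λ l → Σ≤ℕ (suc n ∸ l) (G l)) ∎
  where
  diagonal : ℕ
  diagonal = Σ≤ℕ n (λ l → G l (suc n ∸ l))
  extend-row : ∀ l → l ≤ n → Σ≤ℕ (n ∸ l) (G l) + G l (suc n ∸ l) ≡ Σ≤ℕ (suc n ∸ l) (G l)
  extend-row l l≤n = begin
    Σ≤ℕ (n ∸ l) (G l) + G l (suc n ∸ l)   ≡⟨ cong (λ z → Σ≤ℕ (n ∸ l) (G l) + G l z) (+-∸-assoc 1 l≤n) ⟩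
    Σ≤ℕ (n ∸ l) (G l) + G l (suc (n ∸ l)) ≡⟨ Σ≤ℕ-suc (n ∸ l) (G l) ⟨
    Σ≤ℕ (suc (n ∸ l)) (G l)               ≡⟨ cong (λ z → Σ≤ℕ z (G l)) (+-∸-assoc 1 l≤n) ⟨
    Σ≤ℕ (suc n ∸ l) (G l)                 ∎

Σ≤ℕ-even : ∀ n (g : ℕ → ℕ) → (∀ l → g (suc (2 * l)) ≡ 0) → Σ≤ℕ (2 * n) g ≡ Σ≤ℕ n (λ l → g (2 * l))
Σ≤ℕ-even zero    g odd≡0 = refl
Σ≤ℕ-even (suc n) g odd≡0 = begin
  Σ≤ℕ (2 * suc n) g                                   ≡⟨ cong (λ z → Σ≤ℕ z g) (*-suc 2 n) ⟩
  Σ≤ℕ (suc (suc (2 * n))) g                           ≡⟨ Σ≤ℕ-suc (suc (2 * n)) g ⟩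
  Σ≤ℕ (suc (2 * n)) g + g (suc (suc (2 * n)))         ≡⟨ cong₂ _+_ (Σ≤ℕ-suc (2 * n) g) (cong g (sym (*-suc 2 n))) ⟩
  Σ≤ℕ (2 * n) g + g (suc (2 * n)) + g (2 * suc n)     ≡⟨ cong (λ z → Σ≤ℕ (2 * n) g + z + g (2 * suc n)) (odd≡0 n) ⟩
  Σ≤ℕ (2 * n) g + 0 + g (2 * suc n)                   ≡⟨ cong (_+ g (2 * suc n)) (trans (+-identityʳ _) (Σ≤ℕ-even n g odd≡0)) ⟩
  Σ≤ℕ n (λ l → g (2 * l)) + g (2 * suc n)             ≡⟨ Σ≤ℕ-suc n _ ⟨
  Σ≤ℕ (suc n) (λ l → g (2 * l))                       ∎

ι : Bool → ℕ
ι b = if b then 1 else 0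

δ : ℕ → ℕ → ℕ
δ a b = ι (a ≡ᵇ b)

δ-refl : ∀ a → δ a a ≡ 1
δ-refl zero    = refl
δ-refl (suc a) = δ-refl a

δ-≢ : ∀ a b → a ≢ b → δ a b ≡ 0
δ-≢ zero    zero    ne = ⊥-elim (ne refl)
δ-≢ zero    (suc b) ne = refl
δ-≢ (suc a) zero    ne = refl
δ-≢ (suc a) (suc b) ne = δ-≢ a b (λ e → ne (cong suc e))

δ-sym : ∀ a b → δ a b ≡ δ b a
δ-sym zero    zero    = refl
δ-sym zero    (suc b) = refl
δ-sym (suc a) zero    = refl
δ-sym (suc a) (suc b) = δ-sym a b

Σ≤ℕ-select : ∀ k a (g : ℕ → ℕ) → a ≤ k → Σ≤ℕ k (λ i → δ i a * g i) ≡ g a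
Σ≤ℕ-select zero    .zero g z≤n = trans (+-identityʳ _) (+-identityʳ _)
Σ≤ℕ-select (suc k) a     g a≤1+k with a ≟ suc k
... | yes refl = begin
  Σ≤ℕ (suc k) (λ i → δ i (suc k) * g i)
    ≡⟨ Σ≤ℕ-suc k _ ⟩
  Σ≤ℕ k (λ i → δ i (suc k) * g i) + δ (suc k) (suc k) * g (suc k)
    ≡⟨ cong₂ _+_ earlier-vanish (cong (_* g (suc k)) (δ-refl (suc k))) ⟩
  0 + 1 * g (suc k)
    ≡⟨ +-identityʳ (g (suc k)) ⟩
  g (suc k) ∎
  where
  earlier-vanish : Σ≤ℕ k (λ i → δ i (suc k) * g i) ≡ 0
  earlier-vanish = Σ≤ℕ-zero k (λ i i≤k → cong (_* g i) (δ-≢ i (suc k) (λ e → 1+n≰n (subst (_≤ k) e i≤k))))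
... | no a≢1+k with m≤n⇒m<n∨m≡n a≤1+k
...   | inj₂ a≡1+k       = ⊥-elim (a≢1+k a≡1+k)
...   | inj₁ (s≤s a≤k) = begin
  Σ≤ℕ (suc k) (λ i → δ i a * g i)
    ≡⟨ Σ≤ℕ-suc k _ ⟩
  Σ≤ℕ k (λ i → δ i a * g i) + δ (suc k) a * g (suc k)
    ≡⟨ cong₂ _+_ (Σ≤ℕ-select k a g a≤k) (cong (_* g (suc k)) (δ-≢ (suc k) a (λ e → a≢1+k (sym e)))) ⟩
  g a + 0
    ≡⟨ +-identityʳ (g a) ⟩
  g a ∎

δ-convolution : ∀ k a c → Σ≤ℕ k (λ i → δ a i * δ c (k ∸ i)) ≡ δ (a + c) k
δ-convolution k a c with a ≤? k
... | yes a≤k = begin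
  Σ≤ℕ k (λ i → δ a i * δ c (k ∸ i)) ≡⟨ ΣL-cong (range k) (λ i → cong (_* δ c (k ∸ i)) (δ-sym a i)) ⟩
  Σ≤ℕ k (λ i → δ i a * δ c (k ∸ i)) ≡⟨ Σ≤ℕ-select k a (λ i → δ c (k ∸ i)) a≤k ⟩
  δ c (k ∸ a)                        ≡⟨ shift-index ⟩
  δ (a + c) k                        ∎
  where
  shift-index : δ c (k ∸ a) ≡ δ (a + c) k
  shift-index with c ≟ k ∸ a
  ... | yes refl = trans (δ-refl c) (sym (trans (cong (δ (a + (k ∸ a))) (sym (m+[n∸m]≡n a≤k))) (δ-refl (a + (k ∸ a)))))
  ... | no c≢k∸a = trans (δ-≢ _ _ c≢k∸a) (sym (δ-≢ (a + c) k (λ e → c≢k∸a (trans (sym (m+n∸m≡n a c)) (cong (_∸ a) e)))))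
... | no a≰k = trans (Σ≤ℕ-zero k (λ i i≤k → cong (_* δ c (k ∸ i)) (δ-≢ a i (λ e → a≰k (subst (_≤ k) (sym e) i≤k)))))
                     (sym (δ-≢ (a + c) k (λ e → a≰k (subst (a ≤_) e (m≤m+n a c)))))

-- Objects of size n are recorded only through their weights (x-exponent, y-exponent);
-- C ≈ D says that every size carries the same multiset of weights.
Class : Set
Class = ℕ → List (ℕ × ℕ)

ΣC : Class → ℕ → (ℕ → ℕ → ℕ) → ℕ
ΣC C n f = ΣL (C n) (λ p → f (proj₁ p) (proj₂ p))

ΣC-cong : (C : Class) (n : ℕ) {f g : ℕ → ℕ → ℕ} → (∀ a b → f a b ≡ g a b) → ΣC C n f ≡ ΣC C n g
ΣC-cong C n e = ΣL-cong (C n) (λ p → e (proj₁ p) (proj₂ p))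

infix 4 _≈_
record _≈_ (C D : Class) : Set where
  constructor mk≈
  field sums : ∀ n f → ΣC C n f ≡ ΣC D n f
open _≈_ public

≈-refl : {C : Class} → C ≈ C
≈-refl = mk≈ (λ n f → refl)

≈-sym : {C D : Class} → C ≈ D → D ≈ C
≈-sym p = mk≈ (λ n f → sym (sums p n f))

≈-trans : {C D E : Class} → C ≈ D → D ≈ E → C ≈ E
≈-trans p q = mk≈ (λ n f → trans (sums p n f) (sums q n f))

≈-setoid : Setoid _ _
≈-setoid = record { Carrier = Class ; _≈_ = _≈_ ; isEquivalence = record { refl = ≈-refl ; sym = ≈-sym ; trans = ≈-trans } }

infixl 6 _⊞_
infixl 7 _⊗_

_⊞_ : Class → Class → Class
(C ⊞ D) n = C n ++ D n

_⊗_ : Class → Class → Class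
(C ⊗ D) n = concatMap (λ l → concatMap (λ p → map (λ q → (proj₁ p + proj₁ q , proj₂ p + proj₂ q)) (D (n ∸ l))) (C l)) (range n)

sizeZero : ℕ → Class
sizeZero a zero    = (a , 0) ∷ []
sizeZero a (suc n) = []

𝟙ᶜ 𝕩ᶜ : Class
𝟙ᶜ = sizeZero 0
𝕩ᶜ = sizeZero 1

ΣC-⊞ : ∀ C D n f → ΣC (C ⊞ D) n f ≡ ΣC C n f + ΣC D n f
ΣC-⊞ C D n f = ΣL-++ (C n) (D n) _

ΣC-⊗ : ∀ C D n f → ΣC (C ⊗ D) n f ≡ Σ≤ℕ n (λ l → ΣC C l (λ a b → ΣC D (n ∸ l) (λ c d → f (a + c) (b + d))))
ΣC-⊗ C D n f = trans (ΣL-concatMap _ (range n) _) (ΣL-cong (range n) (λ l →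
   trans (ΣL-concatMap _ (C l) _) (ΣL-cong (C l) (λ p → ΣL-map _ (D (n ∸ l)) _))))

⊞-cong : {C C' D D' : Class} → C ≈ C' → D ≈ D' → C ⊞ D ≈ C' ⊞ D'
⊞-cong {C} {C'} {D} {D'} p q = mk≈ λ n f → begin
  ΣC (C ⊞ D) n f         ≡⟨ ΣC-⊞ C D n f ⟩
  ΣC C n f + ΣC D n f    ≡⟨ cong₂ _+_ (sums p n f) (sums q n f) ⟩
  ΣC C' n f + ΣC D' n f  ≡⟨ ΣC-⊞ C' D' n f ⟨
  ΣC (C' ⊞ D') n f       ∎

⊞-congʳ : (C : Class) {D D' : Class} → D ≈ D' → C ⊞ D ≈ C ⊞ D'
⊞-congʳ C p = ⊞-cong (≈-refl {C}) p

⊞-assoc : (C D E : Class) → C ⊞ D ⊞ E ≈ C ⊞ (D ⊞ E)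
⊞-assoc C D E = mk≈ λ n f → begin
  ΣC (C ⊞ D ⊞ E) n f                ≡⟨ trans (ΣC-⊞ (C ⊞ D) E n f) (cong (_+ ΣC E n f) (ΣC-⊞ C D n f)) ⟩
  ΣC C n f + ΣC D n f + ΣC E n f    ≡⟨ +-assoc (ΣC C n f) _ _ ⟩
  ΣC C n f + (ΣC D n f + ΣC E n f)  ≡⟨ trans (ΣC-⊞ C (D ⊞ E) n f) (cong (ΣC C n f +_) (ΣC-⊞ D E n f)) ⟨
  ΣC (C ⊞ (D ⊞ E)) n f              ∎

⊞-cancelˡ : (C D E : Class) → C ⊞ D ≈ C ⊞ E → D ≈ E
⊞-cancelˡ C D E p = mk≈ λ n f →
  +-cancelˡ-≡ (ΣC C n f) _ _ (trans (sym (ΣC-⊞ C D n f)) (trans (sums p n f) (ΣC-⊞ C E n f)))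

⊗-cong : {C C' D D' : Class} → C ≈ C' → D ≈ D' → C ⊗ D ≈ C' ⊗ D'
⊗-cong {C} {C'} {D} {D'} p q = mk≈ λ n f → begin
  ΣC (C ⊗ D) n f
    ≡⟨ ΣC-⊗ C D n f ⟩
  Σ≤ℕ n (λ l → ΣC C l (λ a b → ΣC D (n ∸ l) (λ c d → f (a + c) (b + d))))
    ≡⟨ ΣL-cong (range n) (λ l → trans (sums p l _) (ΣC-cong C' l (λ a b → sums q (n ∸ l) _))) ⟩
  Σ≤ℕ n (λ l → ΣC C' l (λ a b → ΣC D' (n ∸ l) (λ c d → f (a + c) (b + d))))
    ≡⟨ ΣC-⊗ C' D' n f ⟨
  ΣC (C' ⊗ D') n f ∎

⊗-congˡ : {C C' : Class} (D : Class) → C ≈ C' → C ⊗ D ≈ C' ⊗ D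
⊗-congˡ D p = ⊗-cong p (≈-refl {D})

⊗-congʳ : (C : Class) {D D' : Class} → D ≈ D' → C ⊗ D ≈ C ⊗ D'
⊗-congʳ C p = ⊗-cong (≈-refl {C}) p

⊗-comm : (C D : Class) → C ⊗ D ≈ D ⊗ C
⊗-comm C D = mk≈ λ n f → begin
  ΣC (C ⊗ D) n f
    ≡⟨ ΣC-⊗ C D n f ⟩
  Σ≤ℕ n (λ l → ΣC C l (λ a b → ΣC D (n ∸ l) (λ c d → f (a + c) (b + d))))
    ≡⟨ Σ≤ℕ-reverse n _ ⟩
  Σ≤ℕ n (λ l → ΣC C (n ∸ l) (λ a b → ΣC D (n ∸ (n ∸ l)) (λ c d → f (a + c) (b + d))))
    ≡⟨ Σ≤ℕ-cong n (λ l l≤n → swap-factors l (m∸[m∸n]≡n l≤n) f) ⟩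
  Σ≤ℕ n (λ l → ΣC D l (λ a b → ΣC C (n ∸ l) (λ c d → f (a + c) (b + d))))
    ≡⟨ ΣC-⊗ D C n f ⟨
  ΣC (D ⊗ C) n f ∎
  where
  swap-factors : ∀ {n} l {l'} → l' ≡ l → ∀ f →
    ΣC C n (λ a b → ΣC D l' (λ c d → f (a + c) (b + d))) ≡ ΣC D l (λ a b → ΣC C n (λ c d → f (a + c) (b + d)))
  swap-factors {n} l refl f =
    trans (ΣL-swap (C n) (D l) _) (ΣC-cong D l (λ c d → ΣC-cong C n (λ a b → cong₂ f (+-comm a c) (+-comm b d))))

⊗-assoc : (C D E : Class) → C ⊗ D ⊗ E ≈ C ⊗ (D ⊗ E)
⊗-assoc C D E = mk≈ λ n f → begin
  ΣC (C ⊗ D ⊗ E) n f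
    ≡⟨ ΣC-⊗ (C ⊗ D) E n f ⟩
  Σ≤ℕ n (λ s → ΣC (C ⊗ D) s (λ a b → ΣC E (n ∸ s) (λ c d → f (a + c) (b + d))))
    ≡⟨ ΣL-cong (range n) (λ s → ΣC-⊗ C D s _) ⟩
  Σ≤ℕ n (λ s → Σ≤ℕ s (λ l → ΣC C l (λ a b → ΣC D (s ∸ l) (λ a' b' → ΣC E (n ∸ s) (λ c d → f (a + a' + c) (b + b' + d))))))
    ≡⟨ Σ≤ℕ-cong n (λ s s≤n → Σ≤ℕ-cong s (λ l l≤s → ΣC-cong C l (λ a b → ΣC-cong D (s ∸ l) (λ a' b' →
          cong (λ z → ΣC E z (λ c d → f (a + a' + c) (b + b' + d))) (cong (n ∸_) (sym (m+[n∸m]≡n l≤s))))))) ⟩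
  Σ≤ℕ n (λ s → Σ≤ℕ s (λ l → G n f l (s ∸ l)))
    ≡⟨ Σ≤ℕ-triangle n (G n f) ⟩
  Σ≤ℕ n (λ l → Σ≤ℕ (n ∸ l) (G n f l))
    ≡⟨ ΣL-cong (range n) (λ l → sym (ΣL-swap (C l) (range (n ∸ l)) _)) ⟩
  Σ≤ℕ n (λ l → ΣC C l (λ a b → Σ≤ℕ (n ∸ l) (λ t → ΣC D t (λ a' b' → ΣC E (n ∸ (l + t)) (λ c d → f (a + a' + c) (b + b' + d))))))
    ≡⟨ ΣL-cong (range n) (λ l → ΣC-cong C l (λ a b → trans (ΣL-cong (range (n ∸ l)) (λ t → ΣC-cong D t (λ a' b' →
          trans (cong (λ z → ΣC E z (λ c d → f (a + a' + c) (b + b' + d))) (sym (∸-+-assoc n l t)))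
                (ΣC-cong E _ (λ c d → cong₂ f (+-assoc a a' c) (+-assoc b b' d))))))
          (sym (ΣC-⊗ D E (n ∸ l) _)))) ⟩
  Σ≤ℕ n (λ l → ΣC C l (λ a b → ΣC (D ⊗ E) (n ∸ l) (λ c d → f (a + c) (b + d))))
    ≡⟨ ΣC-⊗ C (D ⊗ E) n f ⟨
  ΣC (C ⊗ (D ⊗ E)) n f ∎
  where
  G : ℕ → (ℕ → ℕ → ℕ) → ℕ → ℕ → ℕ
  G n f l t = ΣC C l (λ a b → ΣC D t (λ a' b' → ΣC E (n ∸ (l + t)) (λ c d → f (a + a' + c) (b + b' + d))))

⊗-distribˡ-⊞ : (C D E : Class) → C ⊗ (D ⊞ E) ≈ C ⊗ D ⊞ C ⊗ E
⊗-distribˡ-⊞ C D E = mk≈ λ n f → begin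
  ΣC (C ⊗ (D ⊞ E)) n f
    ≡⟨ ΣC-⊗ C (D ⊞ E) n f ⟩
  Σ≤ℕ n (λ l → ΣC C l (λ a b → ΣC (D ⊞ E) (n ∸ l) (λ c d → f (a + c) (b + d))))
    ≡⟨ ΣL-cong (range n) (λ l → trans (ΣC-cong C l (λ a b → ΣC-⊞ D E (n ∸ l) _)) (ΣL-+ (C l) _ _)) ⟩
  Σ≤ℕ n (λ l → ΣC C l (λ a b → ΣC D (n ∸ l) (λ c d → f (a + c) (b + d))) + ΣC C l (λ a b → ΣC E (n ∸ l) (λ c d → f (a + c) (b + d))))
    ≡⟨ ΣL-+ (range n) _ _ ⟩
  _ ≡⟨ cong₂ _+_ (ΣC-⊗ C D n f) (ΣC-⊗ C E n f) ⟨
  ΣC (C ⊗ D) n f + ΣC (C ⊗ E) n f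
    ≡⟨ ΣC-⊞ (C ⊗ D) (C ⊗ E) n f ⟨
  ΣC (C ⊗ D ⊞ C ⊗ E) n f ∎

⊗-distribʳ-⊞ : (C D E : Class) → (C ⊞ D) ⊗ E ≈ C ⊗ E ⊞ D ⊗ E
⊗-distribʳ-⊞ C D E =
  ≈-trans (⊗-comm (C ⊞ D) E) (≈-trans (⊗-distribˡ-⊞ E C D) (⊞-cong (⊗-comm E C) (⊗-comm E D)))

ΣC-sizeZero⊗ : ∀ a C n f → ΣC (sizeZero a ⊗ C) n f ≡ ΣC C n (λ c d → f (a + c) d)
ΣC-sizeZero⊗ a C n f = trans (ΣC-⊗ (sizeZero a) C n f) (only-size-zero n)
  where
  only-size-zero : ∀ n → Σ≤ℕ n (λ l → ΣC (sizeZero a) l (λ a' b → ΣC C (n ∸ l) (λ c d → f (a' + c) (b + d))))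
                          ≡ ΣC C n (λ c d → f (a + c) d)
  only-size-zero zero    = trans (+-identityʳ _) (+-identityʳ _)
  only-size-zero (suc n) = begin
    Σ≤ℕ (suc n) (λ l → ΣC (sizeZero a) l (λ a' b → ΣC C (suc n ∸ l) (λ c d → f (a' + c) (b + d))))
      ≡⟨ Σ≤ℕ-shift n _ ⟩
    (ΣC C (suc n) (λ c d → f (a + c) d) + 0) + Σ≤ℕ n (λ _ → 0)
      ≡⟨ cong₂ _+_ (+-identityʳ _) (ΣL-zero (range n) _ (λ _ → refl)) ⟩
    ΣC C (suc n) (λ c d → f (a + c) d) + 0
      ≡⟨ +-identityʳ _ ⟩
    ΣC C (suc n) (λ c d → f (a + c) d) ∎

𝟙ᶜ-identityˡ : (C : Class) → 𝟙ᶜ ⊗ C ≈ C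
𝟙ᶜ-identityˡ C = mk≈ (ΣC-sizeZero⊗ 0 C)

gf : Class → FPS
gf C k m n = pos (ΣC C n (λ a b → δ a k * δ b m))

Σ≤-cong : ∀ n {f g : ℕ → ℤ} → (∀ i → f i ≡ g i) → Σ≤ n f ≡ Σ≤ n g
Σ≤-cong zero    e = e 0
Σ≤-cong (suc n) e = cong₂ ℤ._+_ (Σ≤-cong n e) (e (suc n))

Σ≤-pos : ∀ n (g : ℕ → ℕ) → Σ≤ n (λ i → pos (g i)) ≡ pos (Σ≤ℕ n g)
Σ≤-pos zero    g = cong pos (sym (+-identityʳ (g 0)))
Σ≤-pos (suc n) g = begin
  Σ≤ n (λ i → pos (g i)) ℤ.+ pos (g (suc n)) ≡⟨ cong (ℤ._+ pos (g (suc n))) (Σ≤-pos n g) ⟩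
  pos (Σ≤ℕ n g) ℤ.+ pos (g (suc n))          ≡⟨ ℤ.pos-+ (Σ≤ℕ n g) (g (suc n)) ⟨
  pos (Σ≤ℕ n g + g (suc n))                  ≡⟨ cong pos (Σ≤ℕ-suc n g) ⟨
  pos (Σ≤ℕ (suc n) g)                        ∎

Σ≤-minus : ∀ n (f g : ℕ → ℤ) → Σ≤ n (λ i → f i ℤ.- g i) ≡ Σ≤ n f ℤ.- Σ≤ n g
Σ≤-minus zero    f g = refl
Σ≤-minus (suc n) f g =
  trans (cong (ℤ._+ (f (suc n) ℤ.- g (suc n))) (Σ≤-minus n f g)) (regroup (Σ≤ n f) (Σ≤ n g) (f (suc n)) (g (suc n)))
  where
  open ℤS
  regroup : ∀ a b c d → (a ℤ.- b) ℤ.+ (c ℤ.- d) ≡ (a ℤ.+ c) ℤ.- (b ℤ.+ d)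
  regroup = solve 4 (λ a b c d → (a :- b) :+ (c :- d) := (a :+ c) :- (b :+ d)) refl

⊛-cong : ∀ {F F' G G' : FPS} → (∀ i j l → F i j l ≡ F' i j l) → (∀ i j l → G i j l ≡ G' i j l) →
  ∀ k m n → (F ⊛ G) k m n ≡ (F' ⊛ G') k m n
⊛-cong eF eG k m n = Σ≤-cong k (λ i → Σ≤-cong m (λ j → Σ≤-cong n (λ l → cong₂ ℤ._*_ (eF _ _ _) (eG _ _ _))))

⊛-distribˡ-⊖ : ∀ F G H k m n → (F ⊛ (G ⊖ H)) k m n ≡ (F ⊛ G) k m n ℤ.- (F ⊛ H) k m n
⊛-distribˡ-⊖ F G H k m n = begin
  (F ⊛ (G ⊖ H)) k m n
    ≡⟨ Σ≤-cong k (λ i → Σ≤-cong m (λ j → Σ≤-cong n (λ l → *-distribˡ-minus (F i j l) _ _))) ⟩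
  Σ≤ k (λ i → Σ≤ m (λ j → Σ≤ n (λ l → F i j l ℤ.* G (k ∸ i) (m ∸ j) (n ∸ l) ℤ.- F i j l ℤ.* H (k ∸ i) (m ∸ j) (n ∸ l))))
    ≡⟨ Σ≤-cong k (λ i → trans (Σ≤-cong m (λ j → Σ≤-minus n _ _)) (Σ≤-minus m _ _)) ⟩
  Σ≤ k (λ i → Σ≤ m (λ j → Σ≤ n (λ l → F i j l ℤ.* G (k ∸ i) (m ∸ j) (n ∸ l))) ℤ.- Σ≤ m (λ j → Σ≤ n (λ l → F i j l ℤ.* H (k ∸ i) (m ∸ j) (n ∸ l))))
    ≡⟨ Σ≤-minus k _ _ ⟩
  (F ⊛ G) k m n ℤ.- (F ⊛ H) k m n ∎
  where
  open ℤS
  *-distribˡ-minus : ∀ a b c → a ℤ.* (b ℤ.- c) ≡ a ℤ.* b ℤ.- a ℤ.* c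
  *-distribˡ-minus = solve 3 (λ a b c → a :* (b :- c) := a :* b :- a :* c) refl

δ²-convolution : ∀ k m a b c d →
  Σ≤ℕ k (λ i → Σ≤ℕ m (λ j → (δ a i * δ b j) * (δ c (k ∸ i) * δ d (m ∸ j)))) ≡ δ (a + c) k * δ (b + d) m
δ²-convolution k m a b c d = begin
  Σ≤ℕ k (λ i → Σ≤ℕ m (λ j → (δ a i * δ b j) * (δ c (k ∸ i) * δ d (m ∸ j))))
    ≡⟨ ΣL-cong (range k) (λ i → ΣL-cong (range m) (λ j → *-interchange (δ a i) (δ b j) (δ c (k ∸ i)) (δ d (m ∸ j)))) ⟩
  Σ≤ℕ k (λ i → Σ≤ℕ m (λ j → (δ a i * δ c (k ∸ i)) * (δ b j * δ d (m ∸ j))))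
    ≡⟨ ΣL-product (range k) (range m) _ _ ⟨
  Σ≤ℕ k (λ i → δ a i * δ c (k ∸ i)) * Σ≤ℕ m (λ j → δ b j * δ d (m ∸ j))
    ≡⟨ cong₂ _*_ (δ-convolution k a c) (δ-convolution m b d) ⟩
  δ (a + c) k * δ (b + d) m ∎

gf-⊗ : ∀ C D k m n → (gf C ⊛ gf D) k m n ≡ gf (C ⊗ D) k m n
gf-⊗ C D k m n = begin
  (gf C ⊛ gf D) k m n
    ≡⟨ Σ≤-cong k (λ i → Σ≤-cong m (λ j → Σ≤-cong n (λ l → sym (ℤ.pos-* (ΣC C l (λ a b → δ a i * δ b j)) _)))) ⟩
  Σ≤ k (λ i → Σ≤ m (λ j → Σ≤ n (λ l → pos (F i j l))))
    ≡⟨ Σ≤-cong k (λ i → trans (Σ≤-cong m (λ j → Σ≤-pos n _)) (Σ≤-pos m _)) ⟩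
  Σ≤ k (λ i → pos (Σ≤ℕ m (λ j → Σ≤ℕ n (λ l → F i j l))))
    ≡⟨ Σ≤-pos k _ ⟩
  pos (Σ≤ℕ k (λ i → Σ≤ℕ m (λ j → Σ≤ℕ n (λ l → F i j l))))
    ≡⟨ cong pos (ΣL-cong (range k) (λ i → ΣL-swap (range m) (range n) _)) ⟩
  pos (Σ≤ℕ k (λ i → Σ≤ℕ n (λ l → Σ≤ℕ m (λ j → F i j l))))
    ≡⟨ cong pos (ΣL-swap (range k) (range n) _) ⟩
  pos (Σ≤ℕ n (λ l → Σ≤ℕ k (λ i → Σ≤ℕ m (λ j → F i j l))))
    ≡⟨ cong pos (ΣL-cong (range n) (λ l → collect l)) ⟩
  pos (Σ≤ℕ n (λ l → ΣC C l (λ a b → ΣC D (n ∸ l) (λ c d → δ (a + c) k * δ (b + d) m))))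
    ≡⟨ cong pos (ΣC-⊗ C D n _) ⟨
  gf (C ⊗ D) k m n ∎
  where
  F : ℕ → ℕ → ℕ → ℕ
  F i j l = ΣC C l (λ a b → δ a i * δ b j) * ΣC D (n ∸ l) (λ c d → δ c (k ∸ i) * δ d (m ∸ j))
  collect : ∀ l → Σ≤ℕ k (λ i → Σ≤ℕ m (λ j → F i j l)) ≡ ΣC C l (λ a b → ΣC D (n ∸ l) (λ c d → δ (a + c) k * δ (b + d) m))
  collect l = begin
    Σ≤ℕ k (λ i → Σ≤ℕ m (λ j → F i j l))
      ≡⟨ ΣL-cong (range k) (λ i → ΣL-cong (range m) (λ j → ΣL-product (C l) (D (n ∸ l)) _ _)) ⟩
    Σ≤ℕ k (λ i → Σ≤ℕ m (λ j → ΣL (C l) (λ p → ΣL (D (n ∸ l)) (λ q → H i j p q))))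
      ≡⟨ ΣL-cong (range k) (λ i → trans (ΣL-swap (range m) (C l) _) (ΣL-cong (C l) (λ p → ΣL-swap (range m) (D (n ∸ l)) _))) ⟩
    Σ≤ℕ k (λ i → ΣL (C l) (λ p → ΣL (D (n ∸ l)) (λ q → Σ≤ℕ m (λ j → H i j p q))))
      ≡⟨ trans (ΣL-swap (range k) (C l) _) (ΣL-cong (C l) (λ p → ΣL-swap (range k) (D (n ∸ l)) _)) ⟩
    ΣL (C l) (λ p → ΣL (D (n ∸ l)) (λ q → Σ≤ℕ k (λ i → Σ≤ℕ m (λ j → H i j p q))))
      ≡⟨ ΣL-cong (C l) (λ p → ΣL-cong (D (n ∸ l)) (λ q → δ²-convolution k m (proj₁ p) (proj₂ p) (proj₁ q) (proj₂ q))) ⟩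
    ΣC C l (λ a b → ΣC D (n ∸ l) (λ c d → δ (a + c) k * δ (b + d) m)) ∎
    where
    H : ℕ → ℕ → (ℕ × ℕ) → (ℕ × ℕ) → ℕ
    H i j p q = (δ (proj₁ p) i * δ (proj₂ p) j) * (δ (proj₁ q) (k ∸ i) * δ (proj₂ q) (m ∸ j))

≡ᵇ≡true⇒≡ : ∀ m n → (m ≡ᵇ n) ≡ true → m ≡ n
≡ᵇ≡true⇒≡ m n e = ≡ᵇ⇒≡ m n (subst T (sym e) _)

≡ᵇ-refl : ∀ m → (m ≡ᵇ m) ≡ true
≡ᵇ-refl zero    = refl
≡ᵇ-refl (suc m) = ≡ᵇ-refl m

≢⇒≡ᵇ≡false : ∀ m n → m ≢ n → (m ≡ᵇ n) ≡ false
≢⇒≡ᵇ≡false zero    zero    ne = ⊥-elim (ne refl)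
≢⇒≡ᵇ≡false zero    (suc n) ne = refl
≢⇒≡ᵇ≡false (suc m) zero    ne = refl
≢⇒≡ᵇ≡false (suc m) (suc n) ne = ≢⇒≡ᵇ≡false m n (λ e → ne (cong suc e))

∧-true : ∀ a {b} → (a ∧ b) ≡ true → a ≡ true × b ≡ true
∧-true true {true} _ = refl , refl

ι-∧-* : ∀ a b x → ι a * (ι b * x) ≡ ι (a ∧ b) * x
ι-∧-* true  b x = +-identityʳ _
ι-∧-* false b x = refl

pos+1 : ∀ h → pos h ℤ.+ ℤ.1ℤ ≡ pos (suc h)
pos+1 h = cong pos (+-comm h 1)

-pos-1 : ∀ d → ℤ.- pos d ℤ.- ℤ.1ℤ ≡ -[1+ d ]
-pos-1 zero    = refl
-pos-1 (suc d) = cong -[1+_] (cong suc (+-identityʳ d))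

-[1+]+1 : ∀ d → -[1+ d ] ℤ.+ ℤ.1ℤ ≡ ℤ.- pos d
-[1+]+1 zero    = refl
-[1+]+1 (suc d) = refl

startsUp startsDown endsUp : Word → Bool
startsUp []      = false
startsUp (b ∷ w) = b
startsDown []      = false
startsDown (b ∷ w) = not b
endsUp []          = false
endsUp (b ∷ [])    = b
endsUp (b ∷ c ∷ w) = endsUp (c ∷ w)

endHeight : ℤ → Word → ℤ
endHeight h []          = h
endHeight h (true ∷ w)  = endHeight (h ℤ.+ ℤ.1ℤ) w
endHeight h (false ∷ w) = endHeight (h ℤ.- ℤ.1ℤ) w

-- isDyckFrom h w: started at height h, w never goes below the axis and ends on it;
-- isNegDyckFrom d w: started at height -d, w never goes above the axis and ends on it.
isDyckFrom isNegDyckFrom : ℕ → Word → Bool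
isDyckFrom h       []          = h ≡ᵇ 0
isDyckFrom h       (true ∷ w)  = isDyckFrom (suc h) w
isDyckFrom zero    (false ∷ w) = false
isDyckFrom (suc h) (false ∷ w) = isDyckFrom h w
isNegDyckFrom d       []          = d ≡ᵇ 0
isNegDyckFrom d       (false ∷ w) = isNegDyckFrom (suc d) w
isNegDyckFrom zero    (true ∷ w)  = false
isNegDyckFrom (suc d) (true ∷ w)  = isNegDyckFrom d w

doubleAscents-∷ : ∀ b w → doubleAscents (b ∷ w) ≡ ι (b ∧ startsUp w) + doubleAscents w
doubleAscents-∷ true  []          = refl
doubleAscents-∷ true  (true ∷ w)  = refl
doubleAscents-∷ true  (false ∷ w) = refl
doubleAscents-∷ false w           = refl

doubleAscents-[_] : ∀ b → doubleAscents (b ∷ []) ≡ 0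
doubleAscents-[ true ]  = refl
doubleAscents-[ false ] = refl

doubleAscents-++ : ∀ u v → doubleAscents (u ++ v) ≡ doubleAscents u + doubleAscents v + ι (endsUp u ∧ startsUp v)
doubleAscents-++ []      v = sym (+-identityʳ (doubleAscents v))
doubleAscents-++ (b ∷ []) v = begin
  doubleAscents (b ∷ v)
    ≡⟨ doubleAscents-∷ b v ⟩
  ι (b ∧ startsUp v) + doubleAscents v
    ≡⟨ +-comm (ι (b ∧ startsUp v)) _ ⟩
  0 + doubleAscents v + ι (b ∧ startsUp v)
    ≡⟨ cong (λ z → z + doubleAscents v + ι (b ∧ startsUp v)) doubleAscents-[ b ] ⟨
  doubleAscents (b ∷ []) + doubleAscents v + ι (b ∧ startsUp v) ∎
doubleAscents-++ (b ∷ c ∷ u) v = begin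
  doubleAscents (b ∷ c ∷ u ++ v)
    ≡⟨ doubleAscents-∷ b (c ∷ u ++ v) ⟩
  ι (b ∧ c) + doubleAscents (c ∷ u ++ v)
    ≡⟨ cong (ι (b ∧ c) +_) (doubleAscents-++ (c ∷ u) v) ⟩
  ι (b ∧ c) + (doubleAscents (c ∷ u) + doubleAscents v + ι (endsUp (c ∷ u) ∧ startsUp v))
    ≡⟨ trans (sym (+-assoc (ι (b ∧ c)) _ _)) (cong (_+ ι (endsUp (c ∷ u) ∧ startsUp v)) (sym (+-assoc (ι (b ∧ c)) _ _))) ⟩
  ι (b ∧ c) + doubleAscents (c ∷ u) + doubleAscents v + ι (endsUp (c ∷ u) ∧ startsUp v)
    ≡⟨ cong (λ z → z + doubleAscents v + ι (endsUp (c ∷ u) ∧ startsUp v)) (doubleAscents-∷ b (c ∷ u)) ⟨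
  doubleAscents (b ∷ c ∷ u) + doubleAscents v + ι (endsUp (c ∷ u) ∧ startsUp v) ∎

underUpsFrom-++ : ∀ h u v → underUpsFrom h (u ++ v) ≡ underUpsFrom h u + underUpsFrom (endHeight h u) v
underUpsFrom-++ h []          v = refl
underUpsFrom-++ h (true ∷ u)  v =
  trans (cong (ι (isNeg h) +_) (underUpsFrom-++ (h ℤ.+ ℤ.1ℤ) u v)) (sym (+-assoc (ι (isNeg h)) _ _))
underUpsFrom-++ h (false ∷ u) v = underUpsFrom-++ (h ℤ.- ℤ.1ℤ) u v

endHeight-++ : ∀ h u v → endHeight h (u ++ v) ≡ endHeight (endHeight h u) v
endHeight-++ h []          v = refl
endHeight-++ h (true ∷ u)  v = endHeight-++ _ u v
endHeight-++ h (false ∷ u) v = endHeight-++ _ u v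

ups-++ : ∀ u v → ups (u ++ v) ≡ ups u + ups v
ups-++ []          v = refl
ups-++ (true ∷ u)  v = cong suc (ups-++ u v)
ups-++ (false ∷ u) v = ups-++ u v

downs-++ : ∀ u v → downs (u ++ v) ≡ downs u + downs v
downs-++ []          v = refl
downs-++ (true ∷ u)  v = downs-++ u v
downs-++ (false ∷ u) v = cong suc (downs-++ u v)

length≡ups+downs : ∀ w → length w ≡ ups w + downs w
length≡ups+downs []          = refl
length≡ups+downs (true ∷ w)  = cong suc (length≡ups+downs w)
length≡ups+downs (false ∷ w) = trans (cong suc (length≡ups+downs w)) (sym (+-suc (ups w) (downs w)))

underUpsFrom≤ups : ∀ h w → underUpsFrom h w ≤ ups w
underUpsFrom≤ups h []          = z≤n
underUpsFrom≤ups h (true ∷ w) with isNeg h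
... | true  = s≤s (underUpsFrom≤ups _ w)
... | false = m≤n⇒m≤1+n (underUpsFrom≤ups _ w)
underUpsFrom≤ups h (false ∷ w) = underUpsFrom≤ups _ w

endHeight-ups-downs : ∀ h w → endHeight h w ≡ h ℤ.+ (pos (ups w) ℤ.- pos (downs w))
endHeight-ups-downs h []          = sym (ℤ.+-identityʳ h)
endHeight-ups-downs h (true ∷ w)  = trans (endHeight-ups-downs (h ℤ.+ ℤ.1ℤ) w)
  (solve 3 (λ h u d → (h :+ con ℤ.1ℤ) :+ (u :- d) := h :+ ((con ℤ.1ℤ :+ u) :- d)) refl h (pos (ups w)) (pos (downs w)))
  where open ℤS
endHeight-ups-downs h (false ∷ w) = trans (endHeight-ups-downs (h ℤ.- ℤ.1ℤ) w)
  (solve 3 (λ h u d → (h :- con ℤ.1ℤ) :+ (u :- d) := h :+ (u :- (con ℤ.1ℤ :+ d))) refl h (pos (ups w)) (pos (downs w)))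
  where open ℤS

endHeight-balanced : ∀ h w → ups w ≡ downs w → endHeight h w ≡ h
endHeight-balanced h w e = begin
  endHeight h w                           ≡⟨ endHeight-ups-downs h w ⟩
  h ℤ.+ (pos (ups w) ℤ.- pos (downs w))   ≡⟨ cong (λ z → h ℤ.+ (pos z ℤ.- pos (downs w))) e ⟩
  h ℤ.+ (pos (downs w) ℤ.- pos (downs w)) ≡⟨ cong (λ z → h ℤ.+ z) (ℤ.+-inverseʳ (pos (downs w))) ⟩
  h ℤ.+ ℤ.0ℤ                              ≡⟨ ℤ.+-identityʳ h ⟩
  h                                       ∎

endHeight-isDyckFrom : ∀ h w → isDyckFrom h w ≡ true → endHeight (pos h) w ≡ pos 0
endHeight-isDyckFrom h       []          e = cong pos (≡ᵇ≡true⇒≡ h 0 e)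
endHeight-isDyckFrom h       (true ∷ w)  e = trans (cong (λ z → endHeight z w) (pos+1 h)) (endHeight-isDyckFrom (suc h) w e)
endHeight-isDyckFrom (suc h) (false ∷ w) e = endHeight-isDyckFrom h w e

endHeight-isNegDyckFrom : ∀ d w → isNegDyckFrom d w ≡ true → endHeight (ℤ.- pos d) w ≡ pos 0
endHeight-isNegDyckFrom d       []          e = cong (λ z → ℤ.- pos z) (≡ᵇ≡true⇒≡ d 0 e)
endHeight-isNegDyckFrom d       (false ∷ w) e = trans (cong (λ z → endHeight z w) (-pos-1 d)) (endHeight-isNegDyckFrom (suc d) w e)
endHeight-isNegDyckFrom (suc d) (true ∷ w)  e = trans (cong (λ z → endHeight z w) (-[1+]+1 d)) (endHeight-isNegDyckFrom d w e)

isDyckFrom-balance : ∀ h w → isDyckFrom h w ≡ true → h + ups w ≡ downs w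
isDyckFrom-balance h       []          e = trans (+-identityʳ h) (≡ᵇ≡true⇒≡ h 0 e)
isDyckFrom-balance h       (true ∷ w)  e = trans (+-suc h (ups w)) (isDyckFrom-balance (suc h) w e)
isDyckFrom-balance (suc h) (false ∷ w) e = cong suc (isDyckFrom-balance h w e)

isNegDyckFrom-balance : ∀ d w → isNegDyckFrom d w ≡ true → ups w ≡ d + downs w
isNegDyckFrom-balance d       []          e = sym (trans (+-identityʳ d) (≡ᵇ≡true⇒≡ d 0 e))
isNegDyckFrom-balance d       (false ∷ w) e = trans (isNegDyckFrom-balance (suc d) w e) (sym (+-suc d (downs w)))
isNegDyckFrom-balance (suc d) (true ∷ w)  e = cong suc (isNegDyckFrom-balance d w e)

isNegDyckFrom-endsUp : ∀ d w → isNegDyckFrom d w ≡ true → null w ≡ false → endsUp w ≡ true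
isNegDyckFrom-endsUp (suc d) (true ∷ [])      e _ = refl
isNegDyckFrom-endsUp d       (false ∷ c ∷ w)  e _ = isNegDyckFrom-endsUp (suc d) (c ∷ w) e refl
isNegDyckFrom-endsUp (suc d) (true ∷ c ∷ w)   e _ = isNegDyckFrom-endsUp d (c ∷ w) e refl

underUpsFrom-below : ∀ d w → ups w ≡ suc d + downs w → 1 ≤ underUpsFrom -[1+ d ] w
underUpsFrom-below d (true ∷ w)  e = s≤s z≤n
underUpsFrom-below d (false ∷ w) e =
  subst (λ z → 1 ≤ underUpsFrom -[1+ z ] w) (cong suc (sym (+-identityʳ d)))
        (underUpsFrom-below (suc d) w (trans e (+-suc (suc d) (downs w))))

isDyckFrom-correct : ∀ h w → isDyckFrom h w ≡ ((h + ups w ≡ᵇ downs w) ∧ (underUpsFrom (pos h) w ≡ᵇ 0))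
isDyckFrom-correct h       []          = trans (sym (∧-identityʳ (h ≡ᵇ 0))) (cong (λ z → (z ≡ᵇ 0) ∧ true) (sym (+-identityʳ h)))
isDyckFrom-correct h       (true ∷ w)  = trans (isDyckFrom-correct (suc h) w)
  (cong₂ _∧_ (cong (_≡ᵇ downs w) (sym (+-suc h (ups w)))) (cong (λ z → underUpsFrom z w ≡ᵇ 0) (sym (pos+1 h))))
isDyckFrom-correct (suc h) (false ∷ w) = isDyckFrom-correct h w
isDyckFrom-correct zero    (false ∷ w) with ups w ≡ᵇ suc (downs w) in eq
... | false = refl
... | true  = sym (≢⇒≡ᵇ≡false (underUpsFrom -[1+ 0 ] w) 0
                    (λ e → 1+n≰n (subst (1 ≤_) e (underUpsFrom-below 0 w (≡ᵇ≡true⇒≡ _ _ eq)))))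

isNegDyckFrom-correct : ∀ d w → isNegDyckFrom d w ≡ ((ups w ≡ᵇ d + downs w) ∧ (underUpsFrom (ℤ.- pos d) w ≡ᵇ ups w))
isNegDyckFrom-correct zero    []          = refl
isNegDyckFrom-correct (suc d) []          = refl
isNegDyckFrom-correct d       (false ∷ w) = trans (isNegDyckFrom-correct (suc d) w)
  (cong₂ _∧_ (cong (ups w ≡ᵇ_) (sym (+-suc d (downs w)))) (cong (λ z → underUpsFrom z w ≡ᵇ ups w) (sym (-pos-1 d))))
isNegDyckFrom-correct zero    (true ∷ w)  = sym (trans (cong ((suc (ups w) ≡ᵇ downs w) ∧_)
  (≢⇒≡ᵇ≡false (underUpsFrom (pos 1) w) (suc (ups w)) (λ e → 1+n≰n (subst (_≤ ups w) e (underUpsFrom≤ups _ w))))) (∧-zeroʳ _))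
isNegDyckFrom-correct (suc d) (true ∷ w)  = trans (isNegDyckFrom-correct d w)
  (cong ((ups w ≡ᵇ d + downs w) ∧_) (cong (λ z → underUpsFrom z w ≡ᵇ ups w) (sym (-[1+]+1 d))))

ups-reverse : ∀ w → ups (reverse w) ≡ ups w
ups-reverse []      = refl
ups-reverse (b ∷ w) = begin
  ups (reverse (b ∷ w))        ≡⟨ cong ups (unfold-reverse b w) ⟩
  ups (reverse w ∷ʳ b)         ≡⟨ ups-++ (reverse w) (b ∷ []) ⟩
  ups (reverse w) + ups (b ∷ []) ≡⟨ cong (_+ ups (b ∷ [])) (ups-reverse w) ⟩
  ups w + ups (b ∷ [])         ≡⟨ +-comm (ups w) _ ⟩
  ups (b ∷ []) + ups w         ≡⟨ ups-++ (b ∷ []) w ⟨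
  ups (b ∷ w)                  ∎

downs-reverse : ∀ w → downs (reverse w) ≡ downs w
downs-reverse []      = refl
downs-reverse (b ∷ w) = begin
  downs (reverse (b ∷ w))          ≡⟨ cong downs (unfold-reverse b w) ⟩
  downs (reverse w ∷ʳ b)           ≡⟨ downs-++ (reverse w) (b ∷ []) ⟩
  downs (reverse w) + downs (b ∷ []) ≡⟨ cong (_+ downs (b ∷ [])) (downs-reverse w) ⟩
  downs w + downs (b ∷ [])         ≡⟨ +-comm (downs w) _ ⟩
  downs (b ∷ []) + downs w         ≡⟨ downs-++ (b ∷ []) w ⟨
  downs (b ∷ w)                    ∎

endsUp-∷ʳ : ∀ u b → endsUp (u ∷ʳ b) ≡ b
endsUp-∷ʳ []          b = refl
endsUp-∷ʳ (c ∷ [])    b = refl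
endsUp-∷ʳ (c ∷ d ∷ u) b = endsUp-∷ʳ (d ∷ u) b

doubleAscents-reverse : ∀ w → doubleAscents (reverse w) ≡ doubleAscents w
doubleAscents-reverse []      = refl
doubleAscents-reverse (b ∷ w) = begin
  doubleAscents (reverse (b ∷ w))
    ≡⟨ cong doubleAscents (unfold-reverse b w) ⟩
  doubleAscents (reverse w ∷ʳ b)
    ≡⟨ doubleAscents-++ (reverse w) (b ∷ []) ⟩
  doubleAscents (reverse w) + doubleAscents (b ∷ []) + ι (endsUp (reverse w) ∧ b)
    ≡⟨ cong₂ (λ x y → x + y + ι (endsUp (reverse w) ∧ b)) (doubleAscents-reverse w) doubleAscents-[ b ] ⟩
  doubleAscents w + 0 + ι (endsUp (reverse w) ∧ b)
    ≡⟨ cong₂ _+_ (+-identityʳ (doubleAscents w)) (cong ι (trans (cong (_∧ b) (endsUp-reverse w)) (∧-comm (startsUp w) b))) ⟩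
  doubleAscents w + ι (b ∧ startsUp w)
    ≡⟨ +-comm (doubleAscents w) _ ⟩
  ι (b ∧ startsUp w) + doubleAscents w
    ≡⟨ doubleAscents-∷ b w ⟨
  doubleAscents (b ∷ w) ∎
  where
  endsUp-reverse : ∀ w → endsUp (reverse w) ≡ startsUp w
  endsUp-reverse []      = refl
  endsUp-reverse (b ∷ w) = trans (cong endsUp (unfold-reverse b w)) (endsUp-∷ʳ (reverse w) b)

ι-isNeg-mirror : ∀ e → ι (isNeg e) + ι (isNeg (ℤ.- (e ℤ.+ ℤ.1ℤ))) ≡ 1
ι-isNeg-mirror (pos n)    = cong (λ z → ι (isNeg (ℤ.- z))) (pos+1 n)
ι-isNeg-mirror -[1+ n ] = begin
  1 + ι (isNeg (ℤ.- (-[1+ n ] ℤ.+ ℤ.1ℤ))) ≡⟨ cong (λ z → 1 + ι (isNeg (ℤ.- z))) (-[1+]+1 n) ⟩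
  1 + ι (isNeg (ℤ.- (ℤ.- pos n)))          ≡⟨ cong (λ z → 1 + ι (isNeg z)) (ℤ.neg-involutive (pos n)) ⟩
  1                                        ∎

-- Reversing w and reflecting it in the axis turns an up step from e to e + 1 into one from
-- -(e + 1) to -e, and exactly one of the two is under the axis.
underUps-reverse : ∀ w c → underUpsFrom c (reverse w) + underUpsFrom (ℤ.- endHeight c (reverse w)) w ≡ ups w
underUps-reverse []          c = refl
underUps-reverse (true ∷ w)  c rewrite unfold-reverse true w = begin
  underUpsFrom c (reverse w ∷ʳ true) + underUpsFrom (ℤ.- endHeight c (reverse w ∷ʳ true)) (true ∷ w)
    ≡⟨ cong₂ _+_ (underUpsFrom-++ c (reverse w) _) (cong (λ z → underUpsFrom (ℤ.- z) (true ∷ w)) (endHeight-++ c (reverse w) _)) ⟩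
  u + (ι (isNeg e) + 0) + (ι (isNeg (ℤ.- (e ℤ.+ ℤ.1ℤ))) + underUpsFrom (ℤ.- (e ℤ.+ ℤ.1ℤ) ℤ.+ ℤ.1ℤ) w)
    ≡⟨ cong (λ z → u + (ι (isNeg e) + 0) + (ι (isNeg (ℤ.- (e ℤ.+ ℤ.1ℤ))) + underUpsFrom z w))
            (ℤS.solve 1 (λ e → ℤS.:- (e ℤS.:+ ℤS.con ℤ.1ℤ) ℤS.:+ ℤS.con ℤ.1ℤ ℤS.:= ℤS.:- e) refl e) ⟩
  u + (ι (isNeg e) + 0) + (ι (isNeg (ℤ.- (e ℤ.+ ℤ.1ℤ))) + underUpsFrom (ℤ.- e) w)
    ≡⟨ ℕS.solve 4 (λ x y z t → x ℕS.:+ (y ℕS.:+ ℕS.con 0) ℕS.:+ (z ℕS.:+ t) ℕS.:= (y ℕS.:+ z) ℕS.:+ (x ℕS.:+ t))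
                  refl u (ι (isNeg e)) (ι (isNeg (ℤ.- (e ℤ.+ ℤ.1ℤ)))) (underUpsFrom (ℤ.- e) w) ⟩
  (ι (isNeg e) + ι (isNeg (ℤ.- (e ℤ.+ ℤ.1ℤ)))) + (u + underUpsFrom (ℤ.- e) w)
    ≡⟨ cong₂ _+_ (ι-isNeg-mirror e) (underUps-reverse w c) ⟩
  suc (ups w) ∎
  where
  e : ℤ
  e = endHeight c (reverse w)
  u : ℕ
  u = underUpsFrom c (reverse w)
underUps-reverse (false ∷ w) c rewrite unfold-reverse false w = begin
  underUpsFrom c (reverse w ∷ʳ false) + underUpsFrom (ℤ.- endHeight c (reverse w ∷ʳ false)) (false ∷ w)
    ≡⟨ cong₂ _+_ (underUpsFrom-++ c (reverse w) _) (cong (λ z → underUpsFrom (ℤ.- z) (false ∷ w)) (endHeight-++ c (reverse w) _)) ⟩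
  underUpsFrom c (reverse w) + 0 + underUpsFrom (ℤ.- (e ℤ.- ℤ.1ℤ) ℤ.- ℤ.1ℤ) w
    ≡⟨ cong₂ _+_ (+-identityʳ _) (cong (λ z → underUpsFrom z w)
            (ℤS.solve 1 (λ e → ℤS.:- (e ℤS.:- ℤS.con ℤ.1ℤ) ℤS.:- ℤS.con ℤ.1ℤ ℤS.:= ℤS.:- e) refl e)) ⟩
  underUpsFrom c (reverse w) + underUpsFrom (ℤ.- e) w
    ≡⟨ underUps-reverse w c ⟩
  ups w ∎
  where
  e : ℤ
  e = endHeight c (reverse w)

ΣL-words-suc : ∀ l (g : Word → ℕ) → ΣL (words (suc l)) g ≡ ΣL (words l) (λ w → g (true ∷ w) + g (false ∷ w))
ΣL-words-suc l g = trans (ΣL-concatMap _ (words l) g) (ΣL-cong (words l) (λ w → cong (g (true ∷ w) +_) (+-identityʳ _)))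

ΣL-words-cong : ∀ l {g h : Word → ℕ} → (∀ w → length w ≡ l → g w ≡ h w) → ΣL (words l) g ≡ ΣL (words l) h
ΣL-words-cong zero        e = cong (_+ 0) (e [] refl)
ΣL-words-cong (suc l) {g} {h} e = begin
  ΣL (words (suc l)) g
    ≡⟨ ΣL-words-suc l g ⟩
  ΣL (words l) (λ w → g (true ∷ w) + g (false ∷ w))
    ≡⟨ ΣL-words-cong l (λ w lw → cong₂ _+_ (e (true ∷ w) (cong suc lw)) (e (false ∷ w) (cong suc lw))) ⟩
  ΣL (words l) (λ w → h (true ∷ w) + h (false ∷ w))
    ≡⟨ ΣL-words-suc l h ⟨
  ΣL (words (suc l)) h ∎

ΣL-words-suc-∷ʳ : ∀ l (g : Word → ℕ) → ΣL (words (suc l)) g ≡ ΣL (words l) (λ w → g (w ∷ʳ true) + g (w ∷ʳ false))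
ΣL-words-suc-∷ʳ zero    g = ΣL-words-suc 0 g
ΣL-words-suc-∷ʳ (suc l) g = begin
  ΣL (words (suc (suc l))) g
    ≡⟨ ΣL-words-suc (suc l) g ⟩
  ΣL (words (suc l)) (λ w → g (true ∷ w) + g (false ∷ w))
    ≡⟨ ΣL-words-suc-∷ʳ l _ ⟩
  ΣL (words l) (λ w → (g (true ∷ w ∷ʳ true) + g (false ∷ w ∷ʳ true)) + (g (true ∷ w ∷ʳ false) + g (false ∷ w ∷ʳ false)))
    ≡⟨ ΣL-cong (words l) (λ w → +-interchange (g (true ∷ w ∷ʳ true)) _ _ _) ⟩
  ΣL (words l) (λ w → (g (true ∷ w ∷ʳ true) + g (true ∷ w ∷ʳ false)) + (g (false ∷ w ∷ʳ true) + g (false ∷ w ∷ʳ false)))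
    ≡⟨ ΣL-words-suc l _ ⟨
  ΣL (words (suc l)) (λ w → g (w ∷ʳ true) + g (w ∷ʳ false)) ∎

ΣL-words-reverse : ∀ l (g : Word → ℕ) → ΣL (words l) g ≡ ΣL (words l) (λ w → g (reverse w))
ΣL-words-reverse zero    g = refl
ΣL-words-reverse (suc l) g = begin
  ΣL (words (suc l)) g
    ≡⟨ ΣL-words-suc-∷ʳ l g ⟩
  ΣL (words l) (λ w → g (w ∷ʳ true) + g (w ∷ʳ false))
    ≡⟨ ΣL-words-reverse l _ ⟩
  ΣL (words l) (λ w → g (reverse w ∷ʳ true) + g (reverse w ∷ʳ false))
    ≡⟨ ΣL-cong (words l) (λ w → cong₂ _+_ (cong g (unfold-reverse true w)) (cong g (unfold-reverse false w))) ⟨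
  ΣL (words l) (λ w → g (reverse (true ∷ w)) + g (reverse (false ∷ w)))
    ≡⟨ ΣL-words-suc l _ ⟨
  ΣL (words (suc l)) (λ w → g (reverse w)) ∎

ΣL-words-split : ∀ L (h : Word → Word → ℕ) →
  Σ≤ℕ L (λ i → ΣL (words i) (λ u → ΣL (words (L ∸ i)) (h u))) ≡ ΣL (words L) (λ w → Σ≤ℕ L (λ i → h (take i w) (drop i w)))
ΣL-words-split zero    h = +-identityʳ _
ΣL-words-split (suc L) h = begin
  Σ≤ℕ (suc L) (λ i → ΣL (words i) (λ u → ΣL (words (suc L ∸ i)) (h u)))
    ≡⟨ Σ≤ℕ-shift L _ ⟩
  (ΣL (words (suc L)) (h []) + 0) + Σ≤ℕ L (λ i → ΣL (words (suc i)) (λ u → ΣL (words (L ∸ i)) (h u)))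
    ≡⟨ cong₂ _+_ (trans (+-identityʳ _) (trans (ΣL-words-suc L (h [])) (ΣL-+ (words L) _ _)))
                 (trans (ΣL-cong (range L) (λ i → trans (ΣL-words-suc i _) (ΣL-+ (words i) _ _))) (ΣL-+ (range L) _ _)) ⟩
  (empty-prefix true + empty-prefix false) + (Σ≤ℕ L (λ i → ΣL (words i) (λ u → ΣL (words (L ∸ i)) (h (true ∷ u))))
                                             + Σ≤ℕ L (λ i → ΣL (words i) (λ u → ΣL (words (L ∸ i)) (h (false ∷ u)))))
    ≡⟨ cong ((empty-prefix true + empty-prefix false) +_)
            (cong₂ _+_ (ΣL-words-split L (λ u → h (true ∷ u))) (ΣL-words-split L (λ u → h (false ∷ u)))) ⟩
  (empty-prefix true + empty-prefix false) + (nonempty-prefix true + nonempty-prefix false)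
    ≡⟨ +-interchange (empty-prefix true) _ _ _ ⟩
  (empty-prefix true + nonempty-prefix true) + (empty-prefix false + nonempty-prefix false)
    ≡⟨ cong₂ _+_ (ΣL-+ (words L) _ _) (ΣL-+ (words L) _ _) ⟨
  ΣL (words L) (λ w → h [] (true ∷ w) + Σ≤ℕ L (λ i → h (true ∷ take i w) (drop i w)))
    + ΣL (words L) (λ w → h [] (false ∷ w) + Σ≤ℕ L (λ i → h (false ∷ take i w) (drop i w)))
    ≡⟨ ΣL-+ (words L) _ _ ⟨
  ΣL (words L) (λ w → (h [] (true ∷ w) + Σ≤ℕ L (λ i → h (true ∷ take i w) (drop i w)))
                      + (h [] (false ∷ w) + Σ≤ℕ L (λ i → h (false ∷ take i w) (drop i w))))
    ≡⟨ ΣL-cong (words L) (λ w → cong₂ _+_ (Σ≤ℕ-shift L _) (Σ≤ℕ-shift L _)) ⟨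
  ΣL (words L) (λ w → Σ≤ℕ (suc L) (λ i → h (take i (true ∷ w)) (drop i (true ∷ w)))
                      + Σ≤ℕ (suc L) (λ i → h (take i (false ∷ w)) (drop i (false ∷ w))))
    ≡⟨ ΣL-words-suc L _ ⟨
  ΣL (words (suc L)) (λ w → Σ≤ℕ (suc L) (λ i → h (take i w) (drop i w))) ∎
  where
  empty-prefix nonempty-prefix : Bool → ℕ
  empty-prefix    b = ΣL (words L) (λ w → h [] (b ∷ w))
  nonempty-prefix b = ΣL (words L) (λ w → Σ≤ℕ L (λ i → h (b ∷ take i w) (drop i w)))

weight : Word → ℕ × ℕ
weight w = doubleAscents w , underUps w

paths : (Word → Bool) → Class
paths X n = map weight (filter (λ w → T? (X w)) (words (2 * n)))

ΣL-filter : ∀ (X : Word → Bool) ws (g : Word → ℕ) → ΣL (filter (λ w → T? (X w)) ws) g ≡ ΣL ws (λ w → ι (X w) * g w)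
ΣL-filter X []       g = refl
ΣL-filter X (w ∷ ws) g with X w
... | true  = cong₂ _+_ (sym (+-identityʳ (g w))) (ΣL-filter X ws g)
... | false = ΣL-filter X ws g

ΣC-paths : ∀ X n f → ΣC (paths X) n f ≡ ΣL (words (2 * n)) (λ w → ι (X w) * f (doubleAscents w) (underUps w))
ΣC-paths X n f = trans (ΣL-map _ (filter (λ w → T? (X w)) (words (2 * n))) _) (ΣL-filter X (words (2 * n)) _)

-- Every Z-word is uniquely u ++ v with an X-word u and a Y-word v, cut at position cut w;
-- the junction creates exactly j double ascents.
module Factorisation
  (X Y Z : Word → Bool) (cut : Word → ℕ) (j : ℕ)
  (unique-cut : ∀ w i → i ≤ length w → (X (take i w) ∧ Y (drop i w)) ≡ ((i ≡ᵇ cut w) ∧ Z w))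
  (cut≤length : ∀ w → cut w ≤ length w)
  (X-balanced : ∀ u → X u ≡ true → ups u ≡ downs u)
  (doubleAscents-join : ∀ u v → X u ≡ true → Y v ≡ true → doubleAscents (u ++ v) ≡ j + (doubleAscents u + doubleAscents v))
  (underUps-join : ∀ u v → X u ≡ true → Y v ≡ true → underUps (u ++ v) ≡ underUps u + underUps v)
  where

  joined : (ℕ → ℕ → ℕ) → Word → Word → ℕ
  joined f u v = ι (X u) * (ι (Y v) * f (j + (doubleAscents u + doubleAscents v)) (underUps u + underUps v))

  X-odd : ∀ l u → length u ≡ suc (2 * l) → X u ≡ false
  X-odd l u lu with X u in eq
  ... | false = refl
  ... | true  = ⊥-elim (even≢odd (ups u) l (begin
    2 * ups u          ≡⟨ cong (ups u +_) (trans (+-identityʳ _) (X-balanced u eq)) ⟩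
    ups u + downs u    ≡⟨ length≡ups+downs u ⟨
    length u           ≡⟨ lu ⟩
    suc (2 * l)        ∎))

  joined-at : ∀ f w i → i ≤ length w →
    joined f (take i w) (drop i w) ≡ δ i (cut w) * (ι (Z w) * f (doubleAscents w) (underUps w))
  joined-at f w i i≤ with X (take i w) ∧ Y (drop i w) in eq
  ... | false = begin
    joined f (take i w) (drop i w)                           ≡⟨ ι-∧-* (X (take i w)) (Y (drop i w)) _ ⟩
    ι (X (take i w) ∧ Y (drop i w)) * _                      ≡⟨ cong (λ z → ι z * _) eq ⟩
    0                                                        ≡⟨ cong (λ z → ι z * _) (trans (sym (unique-cut w i i≤)) eq) ⟨
    ι ((i ≡ᵇ cut w) ∧ Z w) * f (doubleAscents w) (underUps w) ≡⟨ ι-∧-* (i ≡ᵇ cut w) (Z w) _ ⟨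
    δ i (cut w) * (ι (Z w) * f (doubleAscents w) (underUps w)) ∎
  ... | true = begin
    joined f (take i w) (drop i w)
      ≡⟨ ι-∧-* (X (take i w)) (Y (drop i w)) _ ⟩
    ι (X (take i w) ∧ Y (drop i w)) * f (j + (doubleAscents (take i w) + doubleAscents (drop i w))) (underUps (take i w) + underUps (drop i w))
      ≡⟨ cong₂ (λ z a → ι z * a) (unique-cut w i i≤) (cong₂ f
           (trans (sym (doubleAscents-join _ _ Xu Yv)) (cong doubleAscents (take++drop≡id i w)))
           (trans (sym (underUps-join _ _ Xu Yv)) (cong underUps (take++drop≡id i w)))) ⟩
    ι ((i ≡ᵇ cut w) ∧ Z w) * f (doubleAscents w) (underUps w)
      ≡⟨ ι-∧-* (i ≡ᵇ cut w) (Z w) _ ⟨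
    δ i (cut w) * (ι (Z w) * f (doubleAscents w) (underUps w)) ∎
    where
    Xu : X (take i w) ≡ true
    Xu = proj₁ (∧-true (X (take i w)) eq)
    Yv : Y (drop i w) ≡ true
    Yv = proj₂ (∧-true (X (take i w)) eq)

  factorise : paths Z ≈ sizeZero j ⊗ (paths X ⊗ paths Y)
  factorise = mk≈ sums-agree
    where
    sums-agree : ∀ n f → ΣC (paths Z) n f ≡ ΣC (sizeZero j ⊗ (paths X ⊗ paths Y)) n f
    sums-agree n f = begin
      ΣC (paths Z) n f
        ≡⟨ ΣC-paths Z n f ⟩
      ΣL (words (2 * n)) (λ w → ι (Z w) * f (doubleAscents w) (underUps w))
        ≡⟨ ΣL-words-cong (2 * n) (λ w lw → trans (Σ≤ℕ-cong (2 * n) (λ i i≤ → joined-at f w i (subst (i ≤_) (sym lw) i≤)))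
              (Σ≤ℕ-select (2 * n) (cut w) _ (subst (cut w ≤_) lw (cut≤length w)))) ⟨
      ΣL (words (2 * n)) (λ w → Σ≤ℕ (2 * n) (λ i → joined f (take i w) (drop i w)))
        ≡⟨ ΣL-words-split (2 * n) (joined f) ⟨
      Σ≤ℕ (2 * n) (λ i → ΣL (words i) (λ u → ΣL (words (2 * n ∸ i)) (joined f u)))
        ≡⟨ Σ≤ℕ-even n _ odd-prefixes-vanish ⟩
      Σ≤ℕ n (λ l → ΣL (words (2 * l)) (λ u → ΣL (words (2 * n ∸ 2 * l)) (joined f u)))
        ≡⟨ ΣL-cong (range n) (λ l → trans (ΣL-cong (words (2 * l)) (λ u →
              trans (cong (λ z → ΣL (words z) (joined f u)) (sym (*-distribˡ-∸ 2 n l)))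
                    (trans (ΣL-*ˡ (words (2 * (n ∸ l))) (ι (X u)) _) (cong (ι (X u) *_) (sym (ΣC-paths Y (n ∸ l) _))))))
              (sym (ΣC-paths X l _))) ⟩
      Σ≤ℕ n (λ l → ΣC (paths X) l (λ a b → ΣC (paths Y) (n ∸ l) (λ c d → f (j + (a + c)) (b + d))))
        ≡⟨ ΣC-⊗ (paths X) (paths Y) n _ ⟨
      ΣC (paths X ⊗ paths Y) n (λ a b → f (j + a) b)
        ≡⟨ ΣC-sizeZero⊗ j (paths X ⊗ paths Y) n f ⟨
      ΣC (sizeZero j ⊗ (paths X ⊗ paths Y)) n f ∎
      where
      odd-prefixes-vanish : ∀ l → ΣL (words (suc (2 * l))) (λ u → ΣL (words (2 * n ∸ suc (2 * l))) (joined f u)) ≡ 0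
      odd-prefixes-vanish l = trans
        (ΣL-words-cong (suc (2 * l)) (λ u lu → ΣL-zero (words (2 * n ∸ suc (2 * l))) (joined f u)
           (λ v → cong (λ z → ι z * _) (X-odd l u lu))))
        (ΣL-zero (words (suc (2 * l))) _ (λ _ → refl))

isDyck isNegDyck isDyck⁺ isNegDyck⁺ startsFlat startsRising startsFalling : Word → Bool
isDyck                = isDyckFrom 0
isNegDyck             = isNegDyckFrom 0
isDyck⁺ w             = isDyck w ∧ not (null w)
isNegDyck⁺ w          = isNegDyck w ∧ not (null w)
startsFlat w          = endsAtZero w ∧ not (startsUp w)
startsRising w        = endsAtZero w ∧ startsUp w
startsFalling w       = endsAtZero w ∧ (startsDown w ∧ not (isNegDyck w))

firstDip : ℕ → Word → ℕ
firstDip h       []          = 0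
firstDip h       (true ∷ w)  = suc (firstDip (suc h) w)
firstDip zero    (false ∷ w) = 0
firstDip (suc h) (false ∷ w) = suc (firstDip h w)

firstRise : ℕ → Word → ℕ
firstRise d       []          = 0
firstRise d       (false ∷ w) = suc (firstRise (suc d) w)
firstRise zero    (true ∷ w)  = 0
firstRise (suc d) (true ∷ w)  = suc (firstRise d w)

firstDip≤length : ∀ h w → firstDip h w ≤ length w
firstDip≤length h       []          = z≤n
firstDip≤length h       (true ∷ w)  = s≤s (firstDip≤length (suc h) w)
firstDip≤length zero    (false ∷ w) = z≤n
firstDip≤length (suc h) (false ∷ w) = s≤s (firstDip≤length h w)

firstRise≤length : ∀ d w → firstRise d w ≤ length w
firstRise≤length d       []          = z≤n
firstRise≤length d       (false ∷ w) = s≤s (firstRise≤length (suc d) w)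
firstRise≤length zero    (true ∷ w)  = z≤n
firstRise≤length (suc d) (true ∷ w)  = s≤s (firstRise≤length d w)

firstDip-unique : ∀ h w i → i ≤ length w →
  (isDyckFrom h (take i w) ∧ startsFlat (drop i w)) ≡ ((i ≡ᵇ firstDip h w) ∧ (h + ups w ≡ᵇ downs w))
firstDip-unique h       []          zero    _ = trans (∧-identityʳ (h ≡ᵇ 0)) (cong (_≡ᵇ 0) (sym (+-identityʳ h)))
firstDip-unique zero    (false ∷ w) zero    _ = ∧-identityʳ _
firstDip-unique zero    (true ∷ w)  zero    _ = ∧-zeroʳ _
firstDip-unique (suc h) (true ∷ w)  zero    _ = refl
firstDip-unique (suc h) (false ∷ w) zero    _ = refl
firstDip-unique h       (true ∷ w)  (suc i) (s≤s i≤) = trans (firstDip-unique (suc h) w i i≤)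
  (cong ((i ≡ᵇ firstDip (suc h) w) ∧_) (cong (_≡ᵇ downs w) (sym (+-suc h (ups w)))))
firstDip-unique zero    (false ∷ w) (suc i) _ = refl
firstDip-unique (suc h) (false ∷ w) (suc i) (s≤s i≤) = firstDip-unique h w i i≤

firstRise-unique : ∀ d w i → i ≤ length w →
  (isNegDyckFrom d (take i w) ∧ startsRising (drop i w)) ≡ ((i ≡ᵇ firstRise d w) ∧ ((ups w ≡ᵇ d + downs w) ∧ not (isNegDyckFrom d w)))
firstRise-unique zero    []          zero    _ = refl
firstRise-unique (suc d) []          zero    _ = refl
firstRise-unique zero    (true ∷ w)  zero    _ = refl
firstRise-unique zero    (false ∷ w) zero    _ = ∧-zeroʳ _
firstRise-unique (suc d) (true ∷ w)  zero    _ = refl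
firstRise-unique (suc d) (false ∷ w) zero    _ = refl
firstRise-unique d       (false ∷ w) (suc i) (s≤s i≤) = trans (firstRise-unique (suc d) w i i≤)
  (cong ((i ≡ᵇ firstRise (suc d) w) ∧_) (cong (λ z → (ups w ≡ᵇ z) ∧ not (isNegDyckFrom (suc d) w)) (sym (+-suc d (downs w)))))
firstRise-unique zero    (true ∷ w)  (suc i) _ = refl
firstRise-unique (suc d) (true ∷ w)  (suc i) (s≤s i≤) = firstRise-unique d w i i≤

firstRise-unique⁺ : ∀ w i → i ≤ length w →
  (isNegDyck⁺ (take i w) ∧ startsRising (drop i w)) ≡ ((i ≡ᵇ firstRise 0 w) ∧ startsFalling w)
firstRise-unique⁺ []          zero    _  = refl
firstRise-unique⁺ (true ∷ w)  zero    _  = sym (∧-zeroʳ (endsAtZero (true ∷ w)))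
firstRise-unique⁺ (true ∷ w)  (suc i) _  = refl
firstRise-unique⁺ (false ∷ w) zero    _  = refl
firstRise-unique⁺ (false ∷ w) (suc i) i≤ =
  trans (cong (_∧ startsRising (drop i w)) (∧-identityʳ (isNegDyckFrom 1 (take i w)))) (firstRise-unique 0 (false ∷ w) (suc i) i≤)

startsFlat⇒¬startsUp : ∀ v → startsFlat v ≡ true → startsUp v ≡ false
startsFlat⇒¬startsUp []          _ = refl
startsFlat⇒¬startsUp (false ∷ v) _ = refl
startsFlat⇒¬startsUp (true ∷ v) eq with proj₂ (∧-true (endsAtZero (true ∷ v)) eq)
... | ()

not-null : (u : Word) → not (null u) ≡ true → null u ≡ false
not-null (_ ∷ _) _ = refl

module Dyck-then-flat = Factorisation isDyck startsFlat endsAtZero (firstDip 0) 0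
  (firstDip-unique 0) (firstDip≤length 0) (isDyckFrom-balance 0)
  (λ u v Xu Yv → begin
    doubleAscents (u ++ v)
      ≡⟨ doubleAscents-++ u v ⟩
    doubleAscents u + doubleAscents v + ι (endsUp u ∧ startsUp v)
      ≡⟨ cong (λ z → doubleAscents u + doubleAscents v + ι (endsUp u ∧ z)) (startsFlat⇒¬startsUp v Yv) ⟩
    doubleAscents u + doubleAscents v + ι (endsUp u ∧ false)
      ≡⟨ cong (λ z → doubleAscents u + doubleAscents v + ι z) (∧-zeroʳ (endsUp u)) ⟩
    doubleAscents u + doubleAscents v + 0
      ≡⟨ +-identityʳ _ ⟩
    doubleAscents u + doubleAscents v ∎)
  (λ u v Xu Yv → trans (underUpsFrom-++ (pos 0) u v) (cong (λ z → underUps u + underUpsFrom z v) (endHeight-isDyckFrom 0 u Xu)))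

isNegDyck⁺⇒isNegDyck : ∀ u → isNegDyck⁺ u ≡ true → isNegDyck u ≡ true
isNegDyck⁺⇒isNegDyck u Xu = proj₁ (∧-true (isNegDyck u) Xu)

isNegDyck⁺-endsUp : ∀ u → isNegDyck⁺ u ≡ true → endsUp u ≡ true
isNegDyck⁺-endsUp u Xu = isNegDyckFrom-endsUp 0 u (isNegDyck⁺⇒isNegDyck u Xu) (not-null u (proj₂ (∧-true (isNegDyck u) Xu)))

module NegDyck-then-rising = Factorisation isNegDyck⁺ startsRising startsFalling (firstRise 0) 1
  firstRise-unique⁺ (firstRise≤length 0) (λ u Xu → isNegDyckFrom-balance 0 u (isNegDyck⁺⇒isNegDyck u Xu))
  (λ u v Xu Yv → begin
    doubleAscents (u ++ v)
      ≡⟨ doubleAscents-++ u v ⟩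
    doubleAscents u + doubleAscents v + ι (endsUp u ∧ startsUp v)
      ≡⟨ cong₂ (λ x y → doubleAscents u + doubleAscents v + ι (x ∧ y)) (isNegDyck⁺-endsUp u Xu) (proj₂ (∧-true (endsAtZero v) Yv)) ⟩
    doubleAscents u + doubleAscents v + 1
      ≡⟨ +-comm _ 1 ⟩
    1 + (doubleAscents u + doubleAscents v) ∎)
  (λ u v Xu Yv → trans (underUpsFrom-++ (pos 0) u v)
                       (cong (λ z → underUps u + underUpsFrom z v) (endHeight-isNegDyckFrom 0 u (isNegDyck⁺⇒isNegDyck u Xu))))

startsDownward : Word → Bool
startsDownward w = endsAtZero w ∧ startsDown w

-- 𝒜: all flawed paths; 𝒫, 𝒬: paths weakly above, resp. below, the axis (⁺: nonempty);
-- 𝒯: flawed paths not starting with U, split into the empty path ℰ and those starting with D (𝒟);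
-- 𝒰⁺: flawed paths starting with U; 𝒵: paths in 𝒟 that rise above the axis.
𝒜 𝒫 𝒫⁺ 𝒬 𝒬⁺ 𝒯 𝒰⁺ 𝒟 𝒵 ℰ : Class
𝒜  = paths endsAtZero
𝒫  = paths isDyck
𝒫⁺ = paths isDyck⁺
𝒬  = paths isNegDyck
𝒬⁺ = paths isNegDyck⁺
𝒯  = paths startsFlat
𝒰⁺ = paths startsRising
𝒟  = paths startsDownward
𝒵  = paths startsFalling
ℰ  = paths null

paths-⊞ : ∀ X Y Z → (∀ w → ι (X w) ≡ ι (Y w) + ι (Z w)) → paths X ≈ paths Y ⊞ paths Z
paths-⊞ X Y Z split = mk≈ λ n f → begin
  ΣC (paths X) n f
    ≡⟨ ΣC-paths X n f ⟩
  ΣL (words (2 * n)) (λ w → ι (X w) * f (doubleAscents w) (underUps w))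
    ≡⟨ ΣL-cong (words (2 * n)) (λ w → trans (cong (_* f (doubleAscents w) (underUps w)) (split w)) (*-distribʳ-+ _ (ι (Y w)) (ι (Z w)))) ⟩
  ΣL (words (2 * n)) (λ w → ι (Y w) * f (doubleAscents w) (underUps w) + ι (Z w) * f (doubleAscents w) (underUps w))
    ≡⟨ ΣL-+ (words (2 * n)) _ _ ⟩
  _ ≡⟨ cong₂ _+_ (ΣC-paths Y n f) (ΣC-paths Z n f) ⟨
  ΣC (paths Y) n f + ΣC (paths Z) n f
    ≡⟨ ΣC-⊞ (paths Y) (paths Z) n f ⟨
  ΣC (paths Y ⊞ paths Z) n f ∎

ℰ≈𝟙ᶜ : ℰ ≈ 𝟙ᶜ
ℰ≈𝟙ᶜ = mk≈ sums-agree
  where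
  sums-agree : ∀ n f → ΣC ℰ n f ≡ ΣC 𝟙ᶜ n f
  sums-agree zero    f = refl
  sums-agree (suc n) f = begin
    ΣC ℰ (suc n) f
      ≡⟨ ΣC-paths null (suc n) f ⟩
    ΣL (words (2 * suc n)) (λ w → ι (null w) * f (doubleAscents w) (underUps w))
      ≡⟨ ΣL-words-cong (2 * suc n) nonempty ⟩
    ΣL (words (2 * suc n)) (λ _ → 0)
      ≡⟨ ΣL-zero (words (2 * suc n)) _ (λ _ → refl) ⟩
    0 ∎
    where
    nonempty : ∀ w → length w ≡ 2 * suc n → ι (null w) * f (doubleAscents w) (underUps w) ≡ 0
    nonempty []      lw with () ← trans lw (*-suc 2 n)
    nonempty (_ ∷ _) lw = refl

𝒜-partition : 𝒜 ≈ 𝒯 ⊞ 𝒰⁺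
𝒜-partition = paths-⊞ endsAtZero startsFlat startsRising (λ w → split (endsAtZero w) (startsUp w))
  where
  split : ∀ a b → ι a ≡ ι (a ∧ not b) + ι (a ∧ b)
  split true  true  = refl
  split true  false = refl
  split false b     = refl

paths-nonempty : ∀ X → X [] ≡ true → paths X ≈ ℰ ⊞ paths (λ w → X w ∧ not (null w))
paths-nonempty X X[] = paths-⊞ X null (λ w → X w ∧ not (null w)) split
  where
  split : ∀ w → ι (X w) ≡ ι (null w) + ι (X w ∧ not (null w))
  split []      rewrite X[] = refl
  split (b ∷ w) = cong ι (sym (∧-identityʳ (X (b ∷ w))))

𝒫-partition : 𝒫 ≈ ℰ ⊞ 𝒫⁺
𝒫-partition = paths-nonempty isDyck refl

𝒬-partition : 𝒬 ≈ ℰ ⊞ 𝒬⁺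
𝒬-partition = paths-nonempty isNegDyck refl

𝒯-partition : 𝒯 ≈ ℰ ⊞ 𝒟
𝒯-partition = paths-⊞ startsFlat null startsDownward split
  where
  split : ∀ w → ι (startsFlat w) ≡ ι (null w) + ι (startsDownward w)
  split []          = refl
  split (true ∷ w)  = refl
  split (false ∷ w) = refl

𝒟-partition : 𝒟 ≈ 𝒬⁺ ⊞ 𝒵
𝒟-partition = paths-⊞ startsDownward isNegDyck⁺ startsFalling split
  where
  split : ∀ w → ι (startsDownward w) ≡ ι (isNegDyck⁺ w) + ι (startsFalling w)
  split []          = refl
  split (true ∷ w)  = refl
  split (false ∷ w) with isNegDyckFrom 1 w in neg
  ... | true  = trans (cong ι (trans (∧-identityʳ _) (balanced (isNegDyckFrom-balance 0 (false ∷ w) neg))))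
                      (cong (λ z → 1 + ι z) (sym (∧-zeroʳ _)))
    where
    balanced : ∀ {x y} → x ≡ 0 + y → (x ≡ᵇ y) ≡ true
    balanced {x} refl = ≡ᵇ-refl x
  ... | false = cong ι (trans (∧-identityʳ _) (sym (∧-identityʳ _)))

𝒜≈𝒫⊗𝒯 : 𝒜 ≈ 𝒫 ⊗ 𝒯
𝒜≈𝒫⊗𝒯 = ≈-trans Dyck-then-flat.factorise (𝟙ᶜ-identityˡ (𝒫 ⊗ 𝒯))

𝒵≈𝕩𝒬⁺𝒰⁺ : 𝒵 ≈ 𝕩ᶜ ⊗ (𝒬⁺ ⊗ 𝒰⁺)
𝒵≈𝕩𝒬⁺𝒰⁺ = NegDyck-then-rising.factorise

module ≈-Reasoning = SetoidReasoning ≈-setoid using (step-≈-⟩; step-≈-⟨) renaming (begin_ to begin≈_; _∎ to _∎≈)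

𝒰⁺≈𝒫⁺𝒯 : 𝒰⁺ ≈ 𝒫⁺ ⊗ 𝒯
𝒰⁺≈𝒫⁺𝒯 = ⊞-cancelˡ 𝒯 𝒰⁺ (𝒫⁺ ⊗ 𝒯) (begin≈
  𝒯 ⊞ 𝒰⁺            ≈⟨ 𝒜-partition ⟨
  𝒜                 ≈⟨ 𝒜≈𝒫⊗𝒯 ⟩
  𝒫 ⊗ 𝒯             ≈⟨ ⊗-congˡ 𝒯 𝒫-partition ⟩
  (ℰ ⊞ 𝒫⁺) ⊗ 𝒯      ≈⟨ ⊗-distribʳ-⊞ ℰ 𝒫⁺ 𝒯 ⟩
  ℰ ⊗ 𝒯 ⊞ 𝒫⁺ ⊗ 𝒯   ≈⟨ ⊞-cong (≈-trans (⊗-congˡ 𝒯 ℰ≈𝟙ᶜ) (𝟙ᶜ-identityˡ 𝒯)) (≈-refl {𝒫⁺ ⊗ 𝒯}) ⟩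
  𝒯 ⊞ 𝒫⁺ ⊗ 𝒯       ∎≈)
  where open ≈-Reasoning

𝒯-equation : 𝒯 ≈ 𝒬 ⊞ 𝕩ᶜ ⊗ (𝒬⁺ ⊗ (𝒫⁺ ⊗ 𝒯))
𝒯-equation = begin≈
  𝒯                                ≈⟨ 𝒯-partition ⟩
  ℰ ⊞ 𝒟                            ≈⟨ ⊞-congʳ ℰ 𝒟-partition ⟩
  ℰ ⊞ (𝒬⁺ ⊞ 𝒵)                     ≈⟨ ⊞-assoc ℰ 𝒬⁺ 𝒵 ⟨
  ℰ ⊞ 𝒬⁺ ⊞ 𝒵                       ≈⟨ ⊞-cong (≈-sym 𝒬-partition) 𝒵≈𝕩𝒬⁺𝒰⁺ ⟩
  𝒬 ⊞ 𝕩ᶜ ⊗ (𝒬⁺ ⊗ 𝒰⁺)               ≈⟨ ⊞-congʳ 𝒬 (⊗-congʳ 𝕩ᶜ (⊗-congʳ 𝒬⁺ 𝒰⁺≈𝒫⁺𝒯)) ⟩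
  𝒬 ⊞ 𝕩ᶜ ⊗ (𝒬⁺ ⊗ (𝒫⁺ ⊗ 𝒯))         ∎≈
  where open ≈-Reasoning

𝒜-equation : 𝒜 ≈ 𝒫 ⊗ 𝒬 ⊞ 𝒜 ⊗ (𝕩ᶜ ⊗ (𝒫⁺ ⊗ 𝒬⁺))
𝒜-equation = begin≈
  𝒜                                      ≈⟨ 𝒜≈𝒫⊗𝒯 ⟩
  𝒫 ⊗ 𝒯                                  ≈⟨ ⊗-congʳ 𝒫 𝒯-equation ⟩
  𝒫 ⊗ (𝒬 ⊞ 𝕩ᶜ ⊗ (𝒬⁺ ⊗ (𝒫⁺ ⊗ 𝒯)))        ≈⟨ ⊗-distribˡ-⊞ 𝒫 𝒬 (𝕩ᶜ ⊗ (𝒬⁺ ⊗ (𝒫⁺ ⊗ 𝒯))) ⟩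
  𝒫 ⊗ 𝒬 ⊞ 𝒫 ⊗ (𝕩ᶜ ⊗ (𝒬⁺ ⊗ (𝒫⁺ ⊗ 𝒯)))    ≈⟨ ⊞-congʳ (𝒫 ⊗ 𝒬) rearrange ⟩
  𝒫 ⊗ 𝒬 ⊞ 𝒜 ⊗ (𝕩ᶜ ⊗ (𝒫⁺ ⊗ 𝒬⁺))          ∎≈
  where
  open ≈-Reasoning
  rearrange : 𝒫 ⊗ (𝕩ᶜ ⊗ (𝒬⁺ ⊗ (𝒫⁺ ⊗ 𝒯))) ≈ 𝒜 ⊗ (𝕩ᶜ ⊗ (𝒫⁺ ⊗ 𝒬⁺))
  rearrange = begin≈
    𝒫 ⊗ (𝕩ᶜ ⊗ (𝒬⁺ ⊗ (𝒫⁺ ⊗ 𝒯)))  ≈⟨ ⊗-congʳ 𝒫 (⊗-congʳ 𝕩ᶜ (⊗-assoc 𝒬⁺ 𝒫⁺ 𝒯)) ⟨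
    𝒫 ⊗ (𝕩ᶜ ⊗ (𝒬⁺ ⊗ 𝒫⁺ ⊗ 𝒯))    ≈⟨ ⊗-congʳ 𝒫 (⊗-congʳ 𝕩ᶜ (⊗-comm (𝒬⁺ ⊗ 𝒫⁺) 𝒯)) ⟩
    𝒫 ⊗ (𝕩ᶜ ⊗ (𝒯 ⊗ (𝒬⁺ ⊗ 𝒫⁺)))  ≈⟨ ⊗-congʳ 𝒫 (⊗-assoc 𝕩ᶜ 𝒯 (𝒬⁺ ⊗ 𝒫⁺)) ⟨
    𝒫 ⊗ (𝕩ᶜ ⊗ 𝒯 ⊗ (𝒬⁺ ⊗ 𝒫⁺))    ≈⟨ ⊗-congʳ 𝒫 (⊗-cong (⊗-comm 𝕩ᶜ 𝒯) (⊗-comm 𝒬⁺ 𝒫⁺)) ⟩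
    𝒫 ⊗ (𝒯 ⊗ 𝕩ᶜ ⊗ (𝒫⁺ ⊗ 𝒬⁺))    ≈⟨ ⊗-congʳ 𝒫 (⊗-assoc 𝒯 𝕩ᶜ (𝒫⁺ ⊗ 𝒬⁺)) ⟩
    𝒫 ⊗ (𝒯 ⊗ (𝕩ᶜ ⊗ (𝒫⁺ ⊗ 𝒬⁺)))  ≈⟨ ⊗-assoc 𝒫 𝒯 (𝕩ᶜ ⊗ (𝒫⁺ ⊗ 𝒬⁺)) ⟨
    𝒫 ⊗ 𝒯 ⊗ (𝕩ᶜ ⊗ (𝒫⁺ ⊗ 𝒬⁺))    ≈⟨ ⊗-congˡ (𝕩ᶜ ⊗ (𝒫⁺ ⊗ 𝒬⁺)) 𝒜≈𝒫⊗𝒯 ⟨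
    𝒜 ⊗ (𝕩ᶜ ⊗ (𝒫⁺ ⊗ 𝒬⁺))         ∎≈

gf-≈ : ∀ {C D} → C ≈ D → ∀ k m n → gf C k m n ≡ gf D k m n
gf-≈ p k m n = cong pos (sums p n _)

gf-⊞ : ∀ C D k m n → gf (C ⊞ D) k m n ≡ gf C k m n ℤ.+ gf D k m n
gf-⊞ C D k m n = trans (cong pos (ΣC-⊞ C D n _)) (ℤ.pos-+ (ΣC C n (λ a b → δ a k * δ b m)) _)

gf-𝟙ᶜ : ∀ k m n → 𝟙 k m n ≡ gf 𝟙ᶜ k m n
gf-𝟙ᶜ zero    zero    zero    = refl
gf-𝟙ᶜ zero    zero    (suc n) = refl
gf-𝟙ᶜ zero    (suc m) zero    = refl
gf-𝟙ᶜ zero    (suc m) (suc n) = refl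
gf-𝟙ᶜ (suc k) zero    zero    = refl
gf-𝟙ᶜ (suc k) zero    (suc n) = refl
gf-𝟙ᶜ (suc k) (suc m) zero    = refl
gf-𝟙ᶜ (suc k) (suc m) (suc n) = refl

gf-𝕩ᶜ : ∀ k m n → 𝕩 k m n ≡ gf 𝕩ᶜ k m n
gf-𝕩ᶜ zero          m       zero    = refl
gf-𝕩ᶜ zero          m       (suc n) = refl
gf-𝕩ᶜ (suc zero)    zero    zero    = refl
gf-𝕩ᶜ (suc zero)    zero    (suc n) = refl
gf-𝕩ᶜ (suc zero)    (suc m) zero    = refl
gf-𝕩ᶜ (suc zero)    (suc m) (suc n) = refl
gf-𝕩ᶜ (suc (suc k)) m       zero    = refl
gf-𝕩ᶜ (suc (suc k)) m       (suc n) = refl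

length-filter : ∀ (p : Word → Bool) ws → length (filter (λ w → T? (p w)) ws) ≡ ΣL ws (λ w → ι (p w))
length-filter p []       = refl
length-filter p (w ∷ ws) with p w
... | true  = cong suc (length-filter p ws)
... | false = length-filter p ws

ι-∧ : ∀ a b → ι (a ∧ b) ≡ ι a * ι b
ι-∧ true  b = sym (+-identityʳ (ι b))
ι-∧ false b = refl

gf-𝒜 : ∀ k m n → A k m n ≡ gf 𝒜 k m n
gf-𝒜 k m n = cong pos (begin
  a n m k
    ≡⟨ length-filter _ (words (2 * n)) ⟩
  ΣL (words (2 * n)) (λ w → ι (endsAtZero w ∧ (underUps w ≡ᵇ m) ∧ (doubleAscents w ≡ᵇ k)))
    ≡⟨ ΣL-cong (words (2 * n)) (λ w → trans (ι-∧ (endsAtZero w) _)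
         (cong (ι (endsAtZero w) *_) (trans (ι-∧ (underUps w ≡ᵇ m) _) (*-comm (δ (underUps w) m) _)))) ⟩
  ΣL (words (2 * n)) (λ w → ι (endsAtZero w) * (δ (doubleAscents w) k * δ (underUps w) m))
    ≡⟨ ΣC-paths endsAtZero n _ ⟨
  ΣC 𝒜 n (λ a b → δ a k * δ b m) ∎)

a-unflawed : ∀ n k → a n 0 k ≡ ΣL (words (2 * n)) (λ w → ι (isDyck w) * δ (doubleAscents w) k)
a-unflawed n k = trans (length-filter _ (words (2 * n))) (ΣL-cong (words (2 * n)) (λ w → begin
  ι (endsAtZero w ∧ (underUps w ≡ᵇ 0) ∧ (doubleAscents w ≡ᵇ k))
    ≡⟨ trans (ι-∧ (endsAtZero w) _) (cong (ι (endsAtZero w) *_) (ι-∧ (underUps w ≡ᵇ 0) _)) ⟩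
  ι (endsAtZero w) * (ι (underUps w ≡ᵇ 0) * δ (doubleAscents w) k)
    ≡⟨ *-assoc (ι (endsAtZero w)) _ _ ⟨
  ι (endsAtZero w) * ι (underUps w ≡ᵇ 0) * δ (doubleAscents w) k
    ≡⟨ cong (λ z → z * δ (doubleAscents w) k) (trans (cong ι (isDyckFrom-correct 0 w)) (ι-∧ (endsAtZero w) _)) ⟨
  ι (isDyck w) * δ (doubleAscents w) k ∎))

A₀[x,z]≡δ*a : ∀ k m n → A₀[x,z] k m n ≡ pos (δ 0 m * a n 0 k)
A₀[x,z]≡δ*a k zero    n = cong pos (sym (+-identityʳ (a n 0 k)))
A₀[x,z]≡δ*a k (suc m) n = refl

A₀[x,yz]≡δ*a : ∀ k m n → A₀[x,yz] k m n ≡ pos (δ n m * a n 0 k)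
A₀[x,yz]≡δ*a k m n with m ≡ᵇ n in eq
... | true  = cong pos (sym (trans (cong (_* a n 0 k) (trans (δ-sym n m) (cong ι eq))) (+-identityʳ _)))
... | false = cong pos (sym (cong (_* a n 0 k) (trans (δ-sym n m) (cong ι eq))))

gf-from-unflawed : ∀ (X : Word → Bool) (size : ℕ → ℕ) →
  (∀ n k m → ΣL (words (2 * n)) (λ w → ι (X w) * (δ (doubleAscents w) k * δ (underUps w) m))
           ≡ ΣL (words (2 * n)) (λ w → δ (size n) m * (ι (isDyck w) * δ (doubleAscents w) k))) →
  ∀ k m n → pos (δ (size n) m * a n 0 k) ≡ gf (paths X) k m n
gf-from-unflawed X size weights k m n = cong pos (begin
  δ (size n) m * a n 0 k
    ≡⟨ cong (δ (size n) m *_) (a-unflawed n k) ⟩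
  δ (size n) m * ΣL (words (2 * n)) (λ w → ι (isDyck w) * δ (doubleAscents w) k)
    ≡⟨ ΣL-*ˡ (words (2 * n)) (δ (size n) m) _ ⟨
  ΣL (words (2 * n)) (λ w → δ (size n) m * (ι (isDyck w) * δ (doubleAscents w) k))
    ≡⟨ weights n k m ⟨
  ΣL (words (2 * n)) (λ w → ι (X w) * (δ (doubleAscents w) k * δ (underUps w) m))
    ≡⟨ ΣC-paths X n _ ⟨
  ΣC (paths X) n (λ a b → δ a k * δ b m) ∎)

dyck-weight : ∀ k m w → ι (isDyck w) * (δ (doubleAscents w) k * δ (underUps w) m) ≡ δ 0 m * (ι (isDyck w) * δ (doubleAscents w) k)
dyck-weight k m w rewrite isDyckFrom-correct 0 w = no-underUps (ups w ≡ᵇ downs w) (underUps w) (δ (doubleAscents w) k)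
  where
  no-underUps : ∀ b u d → ι (b ∧ (u ≡ᵇ 0)) * (d * δ u m) ≡ δ 0 m * (ι (b ∧ (u ≡ᵇ 0)) * d)
  no-underUps b zero    d = ℕS.solve 3 (λ x d y → x ℕS.:* (d ℕS.:* y) ℕS.:= y ℕS.:* (x ℕS.:* d)) refl (ι (b ∧ true)) d (δ 0 m)
  no-underUps b (suc u) d rewrite ∧-zeroʳ b = sym (*-zeroʳ (δ 0 m))

mirror-indicator : ∀ n k m U D x y e → (U ≡ D → x + y ≡ U) → (U ≡ D → U ≡ n) →
  ι ((U ≡ᵇ D) ∧ (x ≡ᵇ U)) * (δ e k * δ x m) ≡ δ n m * (ι ((U ≡ᵇ D) ∧ (y ≡ᵇ 0)) * δ e k)
mirror-indicator n k m U D x y e x+y≡U U≡n with U ≡ᵇ D in balanced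
... | false = sym (*-zeroʳ (δ n m))
... | true with y
...   | zero = begin
  ι (x ≡ᵇ U) * (δ e k * δ x m) ≡⟨ cong (λ z → ι (z ≡ᵇ U) * (δ e k * δ z m)) x≡U ⟩
  ι (U ≡ᵇ U) * (δ e k * δ U m) ≡⟨ cong (λ z → ι z * (δ e k * δ U m)) (≡ᵇ-refl U) ⟩
  δ e k * δ U m + 0            ≡⟨ +-identityʳ _ ⟩
  δ e k * δ U m                ≡⟨ cong (λ z → δ e k * δ z m) (U≡n (≡ᵇ≡true⇒≡ U D balanced)) ⟩
  δ e k * δ n m                ≡⟨ *-comm (δ e k) (δ n m) ⟩
  δ n m * δ e k                ≡⟨ cong (δ n m *_) (+-identityʳ (δ e k)) ⟨
  δ n m * (1 * δ e k)          ∎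
  where
  x≡U : x ≡ U
  x≡U = trans (sym (+-identityʳ x)) (x+y≡U (≡ᵇ≡true⇒≡ U D balanced))
...   | suc y' = trans (cong (λ z → ι z * (δ e k * δ x m)) (≢⇒≡ᵇ≡false x U x≢U)) (sym (*-zeroʳ (δ n m)))
  where
  x≢U : x ≢ U
  x≢U x≡U = 1+n≰n (≤-trans (s≤s (m≤m+n x y'))
                           (≤-reflexive (trans (sym (+-suc x y')) (trans (x+y≡U (≡ᵇ≡true⇒≡ U D balanced)) (sym x≡U)))))

-- By underUps-reverse, the reversal of a balanced word w has all its up steps under the axis
-- exactly when w has none; for |w| = 2n there are n of them, whence the weight yⁿ of A₀(x,yz).
reverse-negDyck-weight : ∀ n k m w → length w ≡ 2 * n →
  ι (isNegDyck (reverse w)) * (δ (doubleAscents (reverse w)) k * δ (underUps (reverse w)) m)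
    ≡ δ n m * (ι (isDyck w) * δ (doubleAscents w) k)
reverse-negDyck-weight n k m w lw = begin
  ι (isNegDyck (reverse w)) * (δ (doubleAscents (reverse w)) k * δ (underUps (reverse w)) m)
    ≡⟨ cong₂ (λ p q → ι p * (δ q k * δ (underUps (reverse w)) m))
         (trans (isNegDyckFrom-correct 0 (reverse w)) (cong₂ (λ p q → (p ≡ᵇ q) ∧ (underUps (reverse w) ≡ᵇ p)) (ups-reverse w) (downs-reverse w)))
         (doubleAscents-reverse w) ⟩
  ι ((ups w ≡ᵇ downs w) ∧ (underUps (reverse w) ≡ᵇ ups w)) * (δ (doubleAscents w) k * δ (underUps (reverse w)) m)
    ≡⟨ mirror-indicator n k m (ups w) (downs w) (underUps (reverse w)) (underUps w) (doubleAscents w) underUps-split ups≡n ⟩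
  δ n m * (ι ((ups w ≡ᵇ downs w) ∧ (underUps w ≡ᵇ 0)) * δ (doubleAscents w) k)
    ≡⟨ cong (λ z → δ n m * (ι z * δ (doubleAscents w) k)) (isDyckFrom-correct 0 w) ⟨
  δ n m * (ι (isDyck w) * δ (doubleAscents w) k) ∎
  where
  underUps-split : ups w ≡ downs w → underUps (reverse w) + underUps w ≡ ups w
  underUps-split balanced = begin
    underUps (reverse w) + underUps w
      ≡⟨ cong (λ z → underUps (reverse w) + underUpsFrom (ℤ.- z) w)
              (endHeight-balanced (pos 0) (reverse w) (trans (ups-reverse w) (trans balanced (sym (downs-reverse w))))) ⟨
    underUps (reverse w) + underUpsFrom (ℤ.- endHeight (pos 0) (reverse w)) w
      ≡⟨ underUps-reverse w (pos 0) ⟩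
    ups w ∎
  ups≡n : ups w ≡ downs w → ups w ≡ n
  ups≡n balanced = *-cancelˡ-≡ (ups w) n 2
    (trans (cong (ups w +_) (trans (+-identityʳ (ups w)) balanced)) (trans (sym (length≡ups+downs w)) lw))

gf-𝒫 : ∀ k m n → A₀[x,z] k m n ≡ gf 𝒫 k m n
gf-𝒫 k m n = trans (A₀[x,z]≡δ*a k m n)
  (gf-from-unflawed isDyck (λ _ → 0) (λ n k m → ΣL-cong (words (2 * n)) (dyck-weight k m)) k m n)

gf-𝒬 : ∀ k m n → A₀[x,yz] k m n ≡ gf 𝒬 k m n
gf-𝒬 k m n = trans (A₀[x,yz]≡δ*a k m n)
  (gf-from-unflawed isNegDyck (λ n → n) (λ n k m →
    trans (ΣL-words-reverse (2 * n) _) (ΣL-words-cong (2 * n) (reverse-negDyck-weight n k m))) k m n)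

gf-minus-𝟙 : ∀ {C C⁺ : Class} {F : FPS} → C ≈ ℰ ⊞ C⁺ → (∀ k m n → F k m n ≡ gf C k m n) →
  ∀ k m n → (F ⊖ 𝟙) k m n ≡ gf C⁺ k m n
gf-minus-𝟙 {C} {C⁺} {F} C-partition F≡gf k m n = begin
  F k m n ℤ.- 𝟙 k m n                          ≡⟨ cong₂ ℤ._-_ (F≡gf k m n) (gf-𝟙ᶜ k m n) ⟩
  gf C k m n ℤ.- gf 𝟙ᶜ k m n                   ≡⟨ cong (ℤ._- gf 𝟙ᶜ k m n) (trans (gf-≈ C-partition k m n) (gf-⊞ ℰ C⁺ k m n)) ⟩
  (gf ℰ k m n ℤ.+ gf C⁺ k m n) ℤ.- gf 𝟙ᶜ k m n ≡⟨ cong (λ z → (z ℤ.+ gf C⁺ k m n) ℤ.- gf 𝟙ᶜ k m n) (gf-≈ ℰ≈𝟙ᶜ k m n) ⟩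
  (gf 𝟙ᶜ k m n ℤ.+ gf C⁺ k m n) ℤ.- gf 𝟙ᶜ k m n ≡⟨ xyx⁻¹≈y (gf 𝟙ᶜ k m n) _ ⟩
  gf C⁺ k m n                                  ∎

lemma4p1 : ∀ (k m n : ℕ) →
    (A ⊛ (𝟙 ⊖ (𝕩 ⊛ ((A₀[x,z] ⊖ 𝟙) ⊛ (A₀[x,yz] ⊖ 𝟙))))) k m n
      ≡ (A₀[x,z] ⊛ A₀[x,yz]) k m n
lemma4p1 k m n = begin
  (A ⊛ (𝟙 ⊖ X)) k m n
    ≡⟨ ⊛-distribˡ-⊖ A 𝟙 X k m n ⟩
  (A ⊛ 𝟙) k m n ℤ.- (A ⊛ X) k m n
    ≡⟨ cong₂ ℤ._-_ A⊛𝟙≡gf A⊛X≡gf ⟩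
  gf 𝒜 k m n ℤ.- gf (𝒜 ⊗ R) k m n
    ≡⟨ cong (ℤ._- gf (𝒜 ⊗ R) k m n) (trans (gf-≈ 𝒜-equation k m n) (gf-⊞ (𝒫 ⊗ 𝒬) (𝒜 ⊗ R) k m n)) ⟩
  (gf (𝒫 ⊗ 𝒬) k m n ℤ.+ gf (𝒜 ⊗ R) k m n) ℤ.- gf (𝒜 ⊗ R) k m n
    ≡⟨ cong (ℤ._- gf (𝒜 ⊗ R) k m n) (ℤ.+-comm (gf (𝒫 ⊗ 𝒬) k m n) (gf (𝒜 ⊗ R) k m n)) ⟩
  (gf (𝒜 ⊗ R) k m n ℤ.+ gf (𝒫 ⊗ 𝒬) k m n) ℤ.- gf (𝒜 ⊗ R) k m n
    ≡⟨ xyx⁻¹≈y (gf (𝒜 ⊗ R) k m n) _ ⟩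
  gf (𝒫 ⊗ 𝒬) k m n
    ≡⟨ trans (⊛-cong gf-𝒫 gf-𝒬 k m n) (gf-⊗ 𝒫 𝒬 k m n) ⟨
  (A₀[x,z] ⊛ A₀[x,yz]) k m n ∎
  where
  X : FPS
  X = 𝕩 ⊛ ((A₀[x,z] ⊖ 𝟙) ⊛ (A₀[x,yz] ⊖ 𝟙))
  R : Class
  R = 𝕩ᶜ ⊗ (𝒫⁺ ⊗ 𝒬⁺)
  A⊛𝟙≡gf : (A ⊛ 𝟙) k m n ≡ gf 𝒜 k m n
  A⊛𝟙≡gf = trans (⊛-cong gf-𝒜 gf-𝟙ᶜ k m n)
                 (trans (gf-⊗ 𝒜 𝟙ᶜ k m n) (gf-≈ (≈-trans (⊗-comm 𝒜 𝟙ᶜ) (𝟙ᶜ-identityˡ 𝒜)) k m n))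
  X≡gf : ∀ i j l → X i j l ≡ gf R i j l
  X≡gf i j l = trans (⊛-cong gf-𝕩ᶜ P⁺Q⁺≡gf i j l) (gf-⊗ 𝕩ᶜ (𝒫⁺ ⊗ 𝒬⁺) i j l)
    where
    P⁺Q⁺≡gf : ∀ i j l → ((A₀[x,z] ⊖ 𝟙) ⊛ (A₀[x,yz] ⊖ 𝟙)) i j l ≡ gf (𝒫⁺ ⊗ 𝒬⁺) i j l
    P⁺Q⁺≡gf i j l = trans (⊛-cong (gf-minus-𝟙 𝒫-partition gf-𝒫) (gf-minus-𝟙 𝒬-partition gf-𝒬) i j l) (gf-⊗ 𝒫⁺ 𝒬⁺ i j l)
  A⊛X≡gf : (A ⊛ X) k m n ≡ gf (𝒜 ⊗ R) k m n
  A⊛X≡gf = trans (⊛-cong gf-𝒜 X≡gf k m n) (gf-⊗ 𝒜 R k m n)
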